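{- Let $j^{\operatorname{last}}_{m,k}(231)$ be the number of $231$-avoiding Jacobi permutations $\pi\in\mathfrak{S}_m$ whose last letter equals $k$. For all $n,k\geq1$, \[ j^{\operatorname{last}}_{2n,k}(231)=\sum_{m=0}^{n-1}\frac{n+k-3m-1}{n+k-1}\binom{n-m-1}{k-2m-1}\binom{n+k-1}{m} \] and \[ j^{\operatorname{last}}_{2n+1,k}(231)=\sum_{m=0}^{n-1}\frac{n+k-3m-1}{n+k-1}\binom{n-m}{k-2m-1}\binom{n+k-1}{m}. \]
   Context: A permutation of a finite set $S$ of positive integers is a word in which each element of $S$ appears exactly once; $\mathfrak{S}_m$ is the set of permutations of $\{1,\dots,m\}$. For a permutation $\pi$ and a letter $x$ of $\pi$, $\rho_\pi(x)$ is the maximal consecutive subword of $\pi$ consisting of the letters immediately to the right of $x$ that are all larger than $x$. $\pi$ is Jacobi if $|\rho_\pi(x)|$ is even for all letters $x$. A permutation $\pi$ avoids a pattern $\sigma$ if no subword of $\pi$ has standardization (relative order) $\sigma$. Binomial coefficients $\binom{a}{b}$ are $0$ when $b<0$ or $b>a$. -}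

module Defs where

open import Data.Nat using (ℕ; zero; suc; _+_; _*_; _∸_; _<_; _<ᵇ_; _%_)
open import Data.Nat.Combinatorics using (_C_)
open import Data.Integer as ℤ using (ℤ; +_; -[1+_])
open import Data.Rational as ℚ using (ℚ)
open import Data.List using (List; []; _∷_; _∷ʳ_; applyUpTo; length)
open import Data.List.Relation.Binary.Permutation.Propositional using (_↭_)
open import Data.List.Relation.Binary.Sublist.Propositional using (_⊆_)
open import Data.List.Relation.Unary.Unique.Propositional using (Unique)
open import Data.List.Membership.Propositional using (_∈_)
open import Data.Bool using (if_then_else_)
open import Data.Product using (Σ; ∃; _×_)
open import Data.Unit using (⊤)
open import Function.Bundles using (_⇔_)
open import Relation.Binary.PropositionalEquality using (_≡_)
open import Relation.Nullary using (¬_)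

range1 : ℕ → List ℕ
range1 m = applyUpTo suc m

IsPerm : ℕ → List ℕ → Set
IsPerm m π = π ↭ range1 m

-- |ρ(x)| given the letters to the right of x: length of the maximal
-- initial run of letters larger than x
runLen : ℕ → List ℕ → ℕ
runLen x []       = 0
runLen x (y ∷ ys) = if x <ᵇ y then suc (runLen x ys) else 0

Jacobi : List ℕ → Set
Jacobi []       = ⊤
Jacobi (x ∷ xs) = (runLen x xs % 2 ≡ 0) × Jacobi xs

Avoids231 : List ℕ → Set
Avoids231 π = ¬ (Σ ℕ λ a → Σ ℕ λ b → Σ ℕ λ c →
                 ((a ∷ b ∷ c ∷ []) ⊆ π) × (c < a) × (a < b))

LastIs : ℕ → List ℕ → Set
LastIs k π = Σ (List ℕ) λ σ → π ≡ σ ∷ʳ k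

JLast : ℕ → ℕ → List ℕ → Set
JLast m k π = IsPerm m π × Jacobi π × Avoids231 π × LastIs k π

HasCount : (List ℕ → Set) → ℕ → Set
HasCount P N = Σ (List (List ℕ)) λ L →
  Unique L × (∀ π → (π ∈ L) ⇔ P π) × (length L ≡ N)

binomZ : ℕ → ℤ → ℕ
binomZ a (+ b)     = a C b
binomZ a -[1+ _ ]  = 0

-- p / d in ℚ (d = 0 never occurs in the use below, since n,k ≥ 1)
frac : ℤ → ℕ → ℚ
frac p zero    = ℚ.0ℚ
frac p (suc d) = p ℚ./ suc d

sumTo : ℕ → (ℕ → ℚ) → ℚ
sumTo zero    f = ℚ.0ℚ
sumTo (suc n) f = sumTo n f ℚ.+ f n

term : ℕ → ℕ → ℕ → ℕ → ℚ
term t n k m =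
  frac (+ (n + k) ℤ.- + (3 * m + 1)) (n + k ∸ 1)
  ℚ.* (+ (binomZ t (+ k ℤ.- + (2 * m + 1))) ℚ./ 1)
  ℚ.* (+ ((n + k ∸ 1) C m) ℚ./ 1)

rhsEven : ℕ → ℕ → ℚ
rhsEven n k = sumTo n (λ m → term (n ∸ m ∸ 1) n k m)

rhsOdd : ℕ → ℕ → ℚ
rhsOdd n k = sumTo n (λ m → term (n ∸ m) n k m)

{-# OPTIONS --safe #-}
module Submission where

-- Around its maximum m + 1, a 231-avoiding permutation of [m + 1] reads α (m + 1) β with every
-- letter of α below every letter of β: it glues a 231-avoiding permutation α of [i] to a shifted
-- one β of [m - i].  It is Jacobi exactly when α and β are and either α is empty or |β| is odd,
-- since the run of the last letter of α is (m + 1) β.  Enumerating the permutations through this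
-- decomposition and sorting them by last letter gives a convolution recursion for the counts.
-- The closed form obeys the same recursion: up to a telescoping term its summands satisfy
-- Pascal's rule, so its values at m + 2 are the prefix sums of its values at m, and exchanging
-- the two sums of the convolution turns one recursion into the other.

module Sum where

  open import Data.Bool using (Bool; true; false)
  open import Data.Nat as ℕ using (ℕ; zero; suc; _<_)
  open import Data.Nat.Properties as ℕ using (m≤n⇒m≤1+n; ≤-refl; ≤-pred; m≤n⇒m<n∨m≡n)
  open import Data.Integer using (ℤ; 0ℤ; 1ℤ; _+_; _-_; _*_)
  open import Data.Integer.Properties using (+-identityˡ; +-identityʳ; +-inverseʳ; *-zeroʳ)
  open import Data.Integer.Tactic.RingSolver using (solve-∀)
  open import Data.Sum using (inj₁; inj₂)
  open import Relation.Binary.PropositionalEquality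
  open import Relation.Nullary using (¬_; yes; no)

  ∑ : ℕ → (ℕ → ℤ) → ℤ
  ∑ zero    f = 0ℤ
  ∑ (suc n) f = ∑ n f + f n

  syntax ∑ n (λ i → e) = ∑[ i < n ] e

  𝟙 : Bool → ℤ
  𝟙 true  = 1ℤ
  𝟙 false = 0ℤ

  ∑-cong : ∀ n {f g : ℕ → ℤ} → (∀ i → i < n → f i ≡ g i) → ∑ n f ≡ ∑ n g
  ∑-cong zero    f≡g = refl
  ∑-cong (suc n) f≡g = cong₂ _+_ (∑-cong n (λ i i<n → f≡g i (m≤n⇒m≤1+n i<n))) (f≡g n ≤-refl)

  ∑-zero : ∀ n {f : ℕ → ℤ} → (∀ i → i < n → f i ≡ 0ℤ) → ∑ n f ≡ 0ℤ
  ∑-zero zero    f≡0 = refl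
  ∑-zero (suc n) f≡0 = cong₂ _+_ (∑-zero n (λ i i<n → f≡0 i (m≤n⇒m≤1+n i<n))) (f≡0 n ≤-refl)

  ∑-single : ∀ n h {f : ℕ → ℤ} → h < n → (∀ i → i < n → ¬ i ≡ h → f i ≡ 0ℤ) → ∑ n f ≡ f h
  ∑-single (suc n) h {f} h<1+n f≡0 with m≤n⇒m<n∨m≡n (≤-pred h<1+n)
  ... | inj₁ h<n = begin
    ∑ n f + f n  ≡⟨ cong₂ _+_ (∑-single n h h<n (λ i i<n → f≡0 i (m≤n⇒m≤1+n i<n)))
                              (f≡0 n ≤-refl (λ n≡h → ℕ.<-irrefl (sym n≡h) h<n)) ⟩
    f h + 0ℤ     ≡⟨ +-identityʳ (f h) ⟩
    f h          ∎
    where open ≡-Reasoning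
  ... | inj₂ refl = begin
    ∑ h f + f h  ≡⟨ cong (_+ f h) (∑-zero h (λ i i<h → f≡0 i (m≤n⇒m≤1+n i<h) (ℕ.<⇒≢ i<h))) ⟩
    0ℤ + f h     ≡⟨ +-identityˡ (f h) ⟩
    f h          ∎
    where open ≡-Reasoning

  ∑-distrib-+ : ∀ n (f g : ℕ → ℤ) → ∑[ i < n ] (f i + g i) ≡ ∑ n f + ∑ n g
  ∑-distrib-+ zero    f g = refl
  ∑-distrib-+ (suc n) f g = trans (cong (_+ (f n + g n)) (∑-distrib-+ n f g)) (interchange (∑ n f) (∑ n g) (f n) (g n))
    where
    interchange : ∀ a b c d → a + b + (c + d) ≡ a + c + (b + d)
    interchange = solve-∀

  ∑-distrib-- : ∀ n (f g : ℕ → ℤ) → ∑[ i < n ] (f i - g i) ≡ ∑ n f - ∑ n g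
  ∑-distrib-- zero    f g = refl
  ∑-distrib-- (suc n) f g = trans (cong (_+ (f n - g n)) (∑-distrib-- n f g)) (interchange (∑ n f) (∑ n g) (f n) (g n))
    where
    interchange : ∀ a b c d → a - b + (c - d) ≡ a + c - (b + d)
    interchange = solve-∀

  ∑-distribˡ-* : ∀ n c (f : ℕ → ℤ) → ∑[ i < n ] (c * f i) ≡ c * ∑ n f
  ∑-distribˡ-* zero    c f = sym (*-zeroʳ c)
  ∑-distribˡ-* (suc n) c f = trans (cong (_+ c * f n) (∑-distribˡ-* n c f)) (distrib c (∑ n f) (f n))
    where
    distrib : ∀ c a b → c * a + c * b ≡ c * (a + b)
    distrib = solve-∀

  ∑-comm : ∀ m n (f : ℕ → ℕ → ℤ) → ∑[ j < m ] ∑[ i < n ] f i j ≡ ∑[ i < n ] ∑[ j < m ] f i j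
  ∑-comm zero    n f = sym (∑-zero n (λ _ _ → refl))
  ∑-comm (suc m) n f = begin
    ∑[ j < m ] ∑[ i < n ] f i j + ∑[ i < n ] f i m  ≡⟨ cong (_+ ∑[ i < n ] f i m) (∑-comm m n f) ⟩
    ∑[ i < n ] ∑[ j < m ] f i j + ∑[ i < n ] f i m  ≡⟨ ∑-distrib-+ n (λ i → ∑[ j < m ] f i j) (λ i → f i m) ⟨
    ∑[ i < n ] (∑[ j < m ] f i j + f i m)           ∎
    where open ≡-Reasoning

  ∑-telescope : ∀ n (G : ℕ → ℤ) → ∑[ i < n ] (G i - G (suc i)) ≡ G 0 - G n
  ∑-telescope zero    G = sym (+-inverseʳ (G 0))
  ∑-telescope (suc n) G = trans (cong (_+ (G n - G (suc n))) (∑-telescope n G)) (cancel (G 0) (G n) (G (suc n)))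
    where
    cancel : ∀ a b c → a - b + (b - c) ≡ a - c
    cancel = solve-∀

  ∑-∸-shift : ∀ (F : ℕ → ℤ) i k → F 0 ≡ 0ℤ → ∑[ j < suc k ] F (j ℕ.∸ i) ≡ ∑[ j < suc (k ℕ.∸ i) ] F j
  ∑-∸-shift F i zero    F0≡0 rewrite ℕ.0∸n≡0 i = refl
  ∑-∸-shift F i (suc k) F0≡0 with i ℕ.≤? k
  ... | yes i≤k = begin
    ∑[ j < suc k ] F (j ℕ.∸ i) + F (suc k ℕ.∸ i)
      ≡⟨ cong₂ _+_ (∑-∸-shift F i k F0≡0) (cong F (ℕ.+-∸-assoc 1 i≤k)) ⟩
    ∑[ j < suc (k ℕ.∸ i) ] F j + F (suc (k ℕ.∸ i))
      ≡⟨ cong (λ n → ∑[ j < suc n ] F j) (ℕ.+-∸-assoc 1 i≤k) ⟨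
    ∑[ j < suc (suc k ℕ.∸ i) ] F j ∎
    where open ≡-Reasoning
  ... | no i≰k = begin
    ∑[ j < suc k ] F (j ℕ.∸ i) + F (suc k ℕ.∸ i)
      ≡⟨ cong₂ _+_ (∑-∸-shift F i k F0≡0) (trans (cong F k+1∸i≡0) F0≡0) ⟩
    ∑[ j < suc (k ℕ.∸ i) ] F j + 0ℤ
      ≡⟨ +-identityʳ _ ⟩
    ∑[ j < suc (k ℕ.∸ i) ] F j
      ≡⟨ cong (λ n → ∑[ j < suc n ] F j) (trans (ℕ.m≤n⇒m∸n≡0 (ℕ.<⇒≤ k<i)) (sym k+1∸i≡0)) ⟩
    ∑[ j < suc (suc k ℕ.∸ i) ] F j ∎
    where
    open ≡-Reasoning
    k<i : k ℕ.< i
    k<i = ℕ.≰⇒> i≰k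
    k+1∸i≡0 : suc k ℕ.∸ i ≡ 0
    k+1∸i≡0 = ℕ.m≤n⇒m∸n≡0 k<i

module Binomial where

  open import Data.Nat as ℕ using (ℕ; zero; suc; _<_)
  open import Data.Nat.Properties as ℕ using (*-zeroʳ; *-identityʳ)
  open import Data.Nat.Combinatorics using (_C_; nCk+nC[k+1]≡[n+1]C[k+1]; nC1≡n; k>n⇒nCk≡0)
  import Data.Nat.Tactic.RingSolver as ℕ-Solver
  open import Data.Integer using (ℤ; +_; -[1+_]; 0ℤ; 1ℤ; _+_; _-_; _*_)
  open import Data.Integer.Properties using (+-comm)
  open import Data.Integer.Tactic.RingSolver using (solve-∀)
  open import Relation.Binary.PropositionalEquality

  [n+1]C[k+1]≡nCk+nC[k+1] : ∀ n k → + (suc n C suc k) ≡ + (n C k) + + (n C suc k)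
  [n+1]C[k+1]≡nCk+nC[k+1] n k = cong +_ (sym (nCk+nC[k+1]≡[n+1]C[k+1] n k))

  [k+1]*[n+1]C[k+1]≡[n+1]*nCk : ∀ n k → suc k ℕ.* (suc n C suc k) ≡ suc n ℕ.* (n C k)
  [k+1]*[n+1]C[k+1]≡[n+1]*nCk zero    zero    = refl
  [k+1]*[n+1]C[k+1]≡[n+1]*nCk zero    (suc k) = *-zeroʳ (suc (suc k))
  [k+1]*[n+1]C[k+1]≡[n+1]*nCk (suc n) zero    = trans (ℕ.+-identityʳ _) (trans (nC1≡n (suc (suc n))) (sym (*-identityʳ _)))
  [k+1]*[n+1]C[k+1]≡[n+1]*nCk (suc n) (suc k) = begin
    suc (suc k) ℕ.* (suc (suc n) C suc (suc k))
      ≡⟨ cong (suc (suc k) ℕ.*_) (pascal (suc n) (suc k)) ⟨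
    suc (suc k) ℕ.* (suc n C suc k ℕ.+ suc n C suc (suc k))
      ≡⟨ expand k (suc n C suc k) (suc n C suc (suc k)) ⟩
    suc k ℕ.* (suc n C suc k) ℕ.+ suc n C suc k ℕ.+ suc (suc k) ℕ.* (suc n C suc (suc k))
      ≡⟨ cong₂ (λ u v → u ℕ.+ suc n C suc k ℕ.+ v) ([k+1]*[n+1]C[k+1]≡[n+1]*nCk n k) ([k+1]*[n+1]C[k+1]≡[n+1]*nCk n (suc k)) ⟩
    suc n ℕ.* (n C k) ℕ.+ suc n C suc k ℕ.+ suc n ℕ.* (n C suc k)
      ≡⟨ cong (λ u → suc n ℕ.* (n C k) ℕ.+ u ℕ.+ suc n ℕ.* (n C suc k)) (pascal n k) ⟨
    suc n ℕ.* (n C k) ℕ.+ (n C k ℕ.+ n C suc k) ℕ.+ suc n ℕ.* (n C suc k)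
      ≡⟨ collect n (n C k) (n C suc k) ⟩
    suc (suc n) ℕ.* (n C k ℕ.+ n C suc k)
      ≡⟨ cong (suc (suc n) ℕ.*_) (pascal n k) ⟩
    suc (suc n) ℕ.* (suc n C suc k) ∎
    where
    open ≡-Reasoning
    pascal : ∀ n k → n C k ℕ.+ n C suc k ≡ suc n C suc k
    pascal = nCk+nC[k+1]≡[n+1]C[k+1]
    expand : ∀ k x y → suc (suc k) ℕ.* (x ℕ.+ y) ≡ suc k ℕ.* x ℕ.+ x ℕ.+ suc (suc k) ℕ.* y
    expand = ℕ-Solver.solve-∀
    collect : ∀ n u v → suc n ℕ.* u ℕ.+ (u ℕ.+ v) ℕ.+ suc n ℕ.* v ≡ suc (suc n) ℕ.* (u ℕ.+ v)
    collect = ℕ-Solver.solve-∀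

  -- Zero as soon as an index is negative; so binom (-1) 0 = 0 and Pascal's rule
  -- below needs a nonnegative upper index.
  binom : ℤ → ℤ → ℤ
  binom (+ n)    (+ k)    = + (n C k)
  binom (+ n)    -[1+ k ] = 0ℤ
  binom -[1+ n ] k        = 0ℤ

  binom-pascal : ∀ n k → binom (+ suc n) k ≡ binom (+ n) k + binom (+ n) (k - 1ℤ)
  binom-pascal n (+ zero)  = refl
  binom-pascal n (+ suc k) = trans ([n+1]C[k+1]≡nCk+nC[k+1] n k) (+-comm (+ (n C k)) (+ (n C suc k)))
  binom-pascal n -[1+ k ]  = refl

  binom-negative : ∀ p r → binom p -[1+ r ] ≡ 0ℤ
  binom-negative (+ n)    r = refl
  binom-negative -[1+ n ] r = refl

  binom-above : ∀ {n k} → n < k → binom (+ n) (+ k) ≡ 0ℤ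
  binom-above n<k = cong +_ (k>n⇒nCk≡0 n<k)

  secondDifference : ℤ → ℤ → ℤ
  secondDifference p q = binom p q - binom p (q - 1ℤ) - binom (p - 1ℤ) q + binom (p - 1ℤ) (q - 1ℤ - 1ℤ)

  secondDifference-pos : ∀ n q → secondDifference (+ suc n) q ≡ 0ℤ
  secondDifference-pos n q rewrite binom-pascal n q | binom-pascal n (q - 1ℤ) =
    cancel (binom (+ n) q) (binom (+ n) (q - 1ℤ)) (binom (+ n) (q - 1ℤ - 1ℤ))
    where
    cancel : ∀ a b c → a + b - (b + c) - a + c ≡ 0ℤ
    cancel = solve-∀

module Formula where

  open import Data.Nat as ℕ using (ℕ; zero; suc; _≤_; _<_; _∸_; z≤n; s≤s; NonZero)
  open import Data.Nat.Properties as ℕ using (+-suc; m≤m+n; m≤n+m; ≤-trans; ≤-pred; m≤n⇒∃[o]m+o≡n; m≤n⇒m<n∨m≡n)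
  open import Data.Nat.Combinatorics using (_C_)
  import Data.Nat.Tactic.RingSolver as ℕ-Solver
  open import Data.Integer using (ℤ; +_; -[1+_]; 0ℤ; 1ℤ; _+_; _-_; _*_; -_)
  open import Data.Integer.Properties using (pos-*; +-inverseʳ; +-identityʳ; *-zeroʳ; i-j≡0⇒i≡j)
  open import Data.Integer.Tactic.RingSolver using (solve-∀)
  open import Data.Product using (Σ-syntax; _×_; _,_)
  open import Data.Sum using (_⊎_; inj₁; inj₂)
  open import Data.Empty using (⊥-elim)
  open import Relation.Nullary using (¬_)
  open import Relation.Binary.PropositionalEquality
  open Sum
  open Binomial

  -- (a - 3m)/a · C(a, m) = C(a, m) - 3 C(a - 1, m - 1), the coefficient in the paper's sum.
  ballot : ℕ → ℕ → ℤ
  ballot a       zero    = 1ℤ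
  ballot zero    (suc m) = 0ℤ
  ballot (suc a) (suc m) = + (suc a C suc m) - + 3 * + (a C m)

  ballotPrev : ℕ → ℕ → ℤ
  ballotPrev a zero    = 0ℤ
  ballotPrev a (suc m) = ballot a m

  ballot-pascal : ∀ a m → .{{NonZero a}} → ballot (suc a) m ≡ ballot a m + ballotPrev a m
  ballot-pascal (suc a) zero          = refl
  ballot-pascal (suc a) (suc zero)    =
    trans (cong (λ z → z - + 3 * 1ℤ) ([n+1]C[k+1]≡nCk+nC[k+1] (suc a) 0)) (rearrange (+ (suc a C 1)))
    where
    rearrange : ∀ x → 1ℤ + x - + 3 * 1ℤ ≡ x - + 3 * 1ℤ + 1ℤ
    rearrange = solve-∀
  ballot-pascal (suc a) (suc (suc m)) =
    trans (cong₂ (λ u v → u - + 3 * v) ([n+1]C[k+1]≡nCk+nC[k+1] (suc a) (suc m)) ([n+1]C[k+1]≡nCk+nC[k+1] a m))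
          (rearrange (+ (suc a C suc m)) (+ (suc a C suc (suc m))) (+ (a C m)) (+ (a C suc m)))
    where
    rearrange : ∀ x y u v → x + y - + 3 * (u + v) ≡ y - + 3 * v + (x - + 3 * u)
    rearrange = solve-∀

  ballot[3m]m≡0 : ∀ m → .{{NonZero m}} → ballot (3 ℕ.* m) m ≡ 0ℤ
  ballot[3m]m≡0 (suc j) = begin
    ballot (3 ℕ.* suc j) (suc j)                  ≡⟨ cong (λ a → ballot a (suc j)) (3[1+j] j) ⟩
    + (suc a C suc j) - + 3 * + (a C j)           ≡⟨ cong (λ z → + z - + 3 * + (a C j)) absorb ⟩
    + (3 ℕ.* (a C j)) - + 3 * + (a C j)           ≡⟨ cong (_- + 3 * + (a C j)) (pos-* 3 (a C j)) ⟩
    + 3 * + (a C j) - + 3 * + (a C j)             ≡⟨ +-inverseʳ (+ 3 * + (a C j)) ⟩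
    0ℤ                                            ∎
    where
    open ≡-Reasoning
    a : ℕ
    a = suc (suc (3 ℕ.* j))
    3[1+j] : ∀ j → 3 ℕ.* suc j ≡ suc (suc (suc (3 ℕ.* j)))
    3[1+j] = ℕ-Solver.solve-∀
    absorb : suc a C suc j ≡ 3 ℕ.* (a C j)
    absorb = ℕ.*-cancelˡ-≡ _ _ (suc j) (trans ([k+1]*[n+1]C[k+1]≡[n+1]*nCk a j) (regroup j (a C j)))
      where
      regroup : ∀ j x → suc (suc (suc (3 ℕ.* j))) ℕ.* x ≡ suc j ℕ.* (3 ℕ.* x)
      regroup = ℕ-Solver.solve-∀

  term : ℕ → ℕ → ℕ → ℕ → ℤ
  term e n k m = ballot (n ℕ.+ k ∸ 1) m * binom (+ n - + m - 1ℤ + + e) (+ k - + 2 * + m - 1ℤ)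

  formula : ℕ → ℕ → ℕ → ℤ
  formula e n k = ∑[ m < n ] term e n k m

  +m-+n≡-[1+r] : ∀ {m n} → m < n → Σ[ r ∈ ℕ ] + m - + n ≡ -[1+ r ]
  +m-+n≡-[1+r] {m} m<n with m≤n⇒∃[o]m+o≡n m<n
  ... | r , refl = r , shift (+ m) (+ r)
    where
    shift : ∀ a b → a - (1ℤ + a + b) ≡ - (1ℤ + b)
    shift = solve-∀

  binom-[k-d]≡0 : ∀ p {k d} → k < d → binom p (+ k - + d) ≡ 0ℤ
  binom-[k-d]≡0 p k<d with +m-+n≡-[1+r] k<d
  ... | r , eq = trans (cong (binom p) eq) (binom-negative p r)

  +k-2m≡-[1+r] : ∀ {k m} → k < 2 ℕ.* m → Σ[ r ∈ ℕ ] + k - + 2 * + m ≡ -[1+ r ]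
  +k-2m≡-[1+r] {k} {m} k<2m with +m-+n≡-[1+r] k<2m
  ... | r , eq = r , trans (cong (λ d → + k - d) (sym (pos-* 2 m))) eq

  binom-[k-2m]≡0 : ∀ p {k m} → k < 2 ℕ.* m → binom p (+ k - + 2 * + m) ≡ 0ℤ
  binom-[k-2m]≡0 p {m = m} k<2m with +k-2m≡-[1+r] {m = m} k<2m
  ... | r , eq = trans (cong (binom p) eq) (binom-negative p r)

  binom-[k-2m-1]≡0 : ∀ p {k m} → k ≤ 2 ℕ.* m → binom p (+ k - + 2 * + m - 1ℤ) ≡ 0ℤ
  binom-[k-2m-1]≡0 p {k} {m} k≤2m =
    trans (cong (binom p) (trans (cong (λ d → + k - d - 1ℤ) (sym (pos-* 2 m))) (shift (+ k) (+ (2 ℕ.* m)))))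
          (binom-[k-d]≡0 p (s≤s k≤2m))
    where
    shift : ∀ a b → a - b - 1ℤ ≡ a - (1ℤ + b)
    shift = solve-∀

  formula-0 : ∀ e n → formula e n 0 ≡ 0ℤ
  formula-0 e n = ∑-zero n λ m _ →
    trans (cong (ballot (n ℕ.+ 0 ∸ 1) m *_) (binom-[k-2m-1]≡0 _ {m = m} z≤n)) (*-zeroʳ (ballot (n ℕ.+ 0 ∸ 1) m))

  formula-1 : ∀ e n → formula e (suc n) 1 ≡ 1ℤ
  formula-1 e n = ∑-single (suc n) 0 (s≤s z≤n) vanish
    where
    vanish : ∀ m → m < suc n → ¬ m ≡ 0 → term e (suc n) 1 m ≡ 0ℤ
    vanish zero    _ 0≢0 = ⊥-elim (0≢0 refl)
    vanish (suc m) _ _   =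
      trans (cong (ballot (suc n ℕ.+ 1 ∸ 1) (suc m) *_) (binom-[k-2m-1]≡0 _ {m = suc m} (s≤s z≤n)))
            (*-zeroʳ (ballot (suc n ℕ.+ 1 ∸ 1) (suc m)))

  formula-above : ∀ e n k → 2 ℕ.* n ℕ.+ e ≤ k → formula e n k ≡ 0ℤ
  formula-above e n k 2n+e≤k = ∑-zero n vanish
    where
    vanish : ∀ m → m < n → term e n k m ≡ 0ℤ
    vanish m m<n with m≤n⇒∃[o]m+o≡n m<n | m≤n⇒∃[o]m+o≡n 2n+e≤k
    ... | o , refl | r , refl =
      trans (cong (X *_) (trans (cong₂ binom upper lower) (binom-above (m≤m+n (suc (o ℕ.+ e)) (o ℕ.+ r)))))
            (*-zeroʳ X)
      where
      X : ℤ
      X = ballot (suc m ℕ.+ o ℕ.+ (2 ℕ.* (suc m ℕ.+ o) ℕ.+ e ℕ.+ r) ∸ 1) m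
      upper : + (suc m ℕ.+ o) - + m - 1ℤ + + e ≡ + (o ℕ.+ e)
      upper = cancel (+ m) (+ o) (+ e)
        where
        cancel : ∀ a b c → 1ℤ + a + b - a - 1ℤ + c ≡ b + c
        cancel = solve-∀
      lower : + (2 ℕ.* (suc m ℕ.+ o) ℕ.+ e ℕ.+ r) - + 2 * + m - 1ℤ ≡ + (suc (o ℕ.+ e) ℕ.+ (o ℕ.+ r))
      lower = trans (cong (λ z → z + + e + + r - + 2 * + m - 1ℤ) (pos-* 2 (suc m ℕ.+ o))) (cancel (+ m) (+ o) (+ e) (+ r))
        where
        cancel : ∀ a b c d → + 2 * (1ℤ + a + b) + c + d - + 2 * a - 1ℤ ≡ 1ℤ + (b + c) + (b + d)
        cancel = solve-∀

  diagonal-cases : ∀ n k → 1 ≤ k → k ≤ 2 ℕ.* n →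
    (Σ[ r ∈ ℕ ] + k - + 2 * + n ≡ -[1+ r ]) ⊎ (+ k - + 2 * + n ≡ 0ℤ × ballot (n ℕ.+ k) n ≡ 0ℤ)
  diagonal-cases n k 1≤k k≤2n with m≤n⇒m<n∨m≡n k≤2n
  ... | inj₁ k<2n = inj₁ (+k-2m≡-[1+r] {m = n} k<2n)
  ... | inj₂ refl = inj₂ (trans (cong (_- + 2 * + n) (pos-* 2 n)) (+-inverseʳ (+ 2 * + n)) , ballot-3n)
    where
    n≢0 : NonZero n
    n≢0 = ℕ.≢-nonZero λ { refl → ℕ.<⇒≱ 1≤k z≤n }
    ballot-3n : ballot (n ℕ.+ 2 ℕ.* n) n ≡ 0ℤ
    ballot-3n = trans (cong (λ a → ballot a n) (n+2n n)) (ballot[3m]m≡0 n {{n≢0}})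
      where
      n+2n : ∀ n → n ℕ.+ 2 ℕ.* n ≡ 3 ℕ.* n
      n+2n = ℕ-Solver.solve-∀

  telescopeTerm : ℕ → ℕ → ℕ → ℕ → ℤ
  telescopeTerm e n k m = ballotPrev (n ℕ.+ k) m * binom (+ n - + m + + e) (+ k - + 2 * + m)

  ballot*secondDifference≡0 : ∀ e n k m → 1 ≤ k → k ≤ 2 ℕ.* n ℕ.+ e → m ≤ n →
    ballot (n ℕ.+ k) m * secondDifference (+ n - + m + + e) (+ k - + 2 * + m) ≡ 0ℤ
  ballot*secondDifference≡0 e n k m 1≤k k≤2n+e m≤n with m≤n⇒m<n∨m≡n m≤n
  ... | inj₁ m<n with m≤n⇒∃[o]m+o≡n m<n
  ...   | o , refl = trans (cong (λ p → X * secondDifference p q) (cancel (+ m) (+ o) (+ e)))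
                           (trans (cong (X *_) (secondDifference-pos (o ℕ.+ e) q)) (*-zeroʳ X))
    where
    X q : ℤ
    X = ballot (suc m ℕ.+ o ℕ.+ k) m
    q = + k - + 2 * + m
    cancel : ∀ a b c → 1ℤ + a + b - a + c ≡ 1ℤ + (b + c)
    cancel = solve-∀
  ballot*secondDifference≡0 e n k m 1≤k k≤2n+e m≤n | inj₂ refl =
    trans (cong (λ p → X * secondDifference p q) (cancel (+ m) (+ e))) (on-diagonal e k≤2n+e)
    where
    X q : ℤ
    X = ballot (m ℕ.+ k) m
    q = + k - + 2 * + m
    cancel : ∀ a c → a - a + c ≡ c
    cancel = solve-∀
    on-diagonal : ∀ e → k ≤ 2 ℕ.* m ℕ.+ e → X * secondDifference (+ e) q ≡ 0ℤ
    on-diagonal (suc e) _ = trans (cong (X *_) (secondDifference-pos e q)) (*-zeroʳ X)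
    on-diagonal zero k≤2m+0 with diagonal-cases m k 1≤k (subst (k ≤_) (ℕ.+-identityʳ (2 ℕ.* m)) k≤2m+0)
    ... | inj₁ (r , q≡) = trans (cong (λ q → X * secondDifference (+ 0) q) q≡) (*-zeroʳ X)
    ... | inj₂ (_ , X≡0) = cong (_* secondDifference (+ 0) q) X≡0

  term-difference : ∀ e n k m → 1 ≤ k → k ≤ 2 ℕ.* n ℕ.+ e → m ≤ n →
    term e (suc n) (suc k) m - term e (suc n) k m - term e n (suc k) m
      ≡ telescopeTerm e n k m - telescopeTerm e n k (suc m)
  term-difference e n k m 1≤k k≤2n+e m≤n = begin
    term e (suc n) (suc k) m - term e (suc n) k m - term e n (suc k) m
      ≡⟨ cong₃ (λ u v w → u - v - w) t₁ t₂ t₃ ⟩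
    (X + Y) * binom p q - X * binom p (q - 1ℤ) - X * binom (p - 1ℤ) q
      ≡⟨ regroup X Y (binom p q) (binom p (q - 1ℤ)) (binom (p - 1ℤ) q) (binom (p - 1ℤ) (q - 1ℤ - 1ℤ)) ⟩
    Y * binom p q - X * binom (p - 1ℤ) (q - 1ℤ - 1ℤ) + X * secondDifference p q
      ≡⟨ cong (λ z → Y * binom p q - X * binom (p - 1ℤ) (q - 1ℤ - 1ℤ) + z)
              (ballot*secondDifference≡0 e n k m 1≤k k≤2n+e m≤n) ⟩
    Y * binom p q - X * binom (p - 1ℤ) (q - 1ℤ - 1ℤ) + 0ℤ
      ≡⟨ +-identityʳ _ ⟩
    Y * binom p q - X * binom (p - 1ℤ) (q - 1ℤ - 1ℤ)
      ≡⟨ cong (λ z → telescopeTerm e n k m - z) next ⟨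
    telescopeTerm e n k m - telescopeTerm e n k (suc m) ∎
    where
    open ≡-Reasoning
    X Y p q : ℤ
    X = ballot (n ℕ.+ k) m
    Y = ballotPrev (n ℕ.+ k) m
    p = + n - + m + + e
    q = + k - + 2 * + m
    cong₃ : ∀ {a b c x y z : ℤ} (f : ℤ → ℤ → ℤ → ℤ) → a ≡ x → b ≡ y → c ≡ z → f a b c ≡ f x y z
    cong₃ f refl refl refl = refl
    regroup : ∀ X Y a b c d → (X + Y) * a - X * b - X * c ≡ Y * a - X * d + X * (a - b - c + d)
    regroup = solve-∀
    upper : + suc n - + m - 1ℤ + + e ≡ p
    upper = shift (+ n) (+ m) (+ e)
      where
      shift : ∀ a b c → 1ℤ + a - b - 1ℤ + c ≡ a - b + c
      shift = solve-∀
    upper-1 : + n - + m - 1ℤ + + e ≡ p - 1ℤ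
    upper-1 = shift (+ n) (+ m) (+ e)
      where
      shift : ∀ a b c → a - b - 1ℤ + c ≡ a - b + c - 1ℤ
      shift = solve-∀
    lower : + suc k - + 2 * + m - 1ℤ ≡ q
    lower = shift (+ k) (+ m)
      where
      shift : ∀ a b → 1ℤ + a - + 2 * b - 1ℤ ≡ a - + 2 * b
      shift = solve-∀
    ballot[n+k] : ballot (n ℕ.+ suc k ∸ 1) m ≡ X
    ballot[n+k] = cong (λ a → ballot (a ∸ 1) m) (+-suc n k)
    n+k≢0 : NonZero (n ℕ.+ k)
    n+k≢0 = ℕ.>-nonZero (≤-trans 1≤k (m≤n+m k n))
    t₁ : term e (suc n) (suc k) m ≡ (X + Y) * binom p q
    t₁ = cong₂ _*_ (trans (cong (λ a → ballot a m) (+-suc n k)) (ballot-pascal (n ℕ.+ k) m {{n+k≢0}})) (cong₂ binom upper lower)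
    t₂ : term e (suc n) k m ≡ X * binom p (q - 1ℤ)
    t₂ = cong (λ u → X * binom u (q - 1ℤ)) upper
    t₃ : term e n (suc k) m ≡ X * binom (p - 1ℤ) q
    t₃ = cong₂ _*_ ballot[n+k] (cong₂ binom upper-1 lower)
    next : telescopeTerm e n k (suc m) ≡ X * binom (p - 1ℤ) (q - 1ℤ - 1ℤ)
    next = cong (X *_) (cong₂ binom (shift (+ n) (+ m) (+ e)) (shift′ (+ k) (+ m)))
      where
      shift : ∀ a b c → a - (1ℤ + b) + c ≡ a - b + c - 1ℤ
      shift = solve-∀
      shift′ : ∀ a b → a - + 2 * (1ℤ + b) ≡ a - + 2 * b - 1ℤ - 1ℤ
      shift′ = solve-∀

  telescopeTerm-last≡0 : ∀ e n k → e ≤ 1 → k ≤ 2 ℕ.* n ℕ.+ e → telescopeTerm e n k (suc n) ≡ 0ℤ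
  telescopeTerm-last≡0 e n k e≤1 k≤2n+e =
    trans (cong (λ p → X * binom p q) (cancel (+ n) (+ e))) (trans (cong (X *_) (vanish e e≤1 k≤2n+e)) (*-zeroʳ X))
    where
    X q : ℤ
    X = ballot (n ℕ.+ k) n
    q = + k - + 2 * + suc n
    cancel : ∀ a c → a - (1ℤ + a) + c ≡ c - 1ℤ
    cancel = solve-∀
    vanish : ∀ e → e ≤ 1 → k ≤ 2 ℕ.* n ℕ.+ e → binom (+ e - 1ℤ) q ≡ 0ℤ
    vanish zero    _         _       = refl
    vanish (suc zero) _      k≤2n+1 = binom-[k-2m]≡0 (+ 0) {m = suc n} (subst (k <_) (2[1+n] n) (s≤s k≤2n+1))
      where
      2[1+n] : ∀ n → suc (2 ℕ.* n ℕ.+ 1) ≡ 2 ℕ.* suc n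
      2[1+n] = ℕ-Solver.solve-∀
    vanish (suc (suc e)) (s≤s ()) _

  term-last≡0 : ∀ e n k → e ≤ 1 → 1 ≤ k → k ≤ 2 ℕ.* n ℕ.+ e → term e n (suc k) n ≡ 0ℤ
  term-last≡0 e n k e≤1 1≤k k≤2n+e =
    trans (cong₂ (λ a p → ballot (a ∸ 1) n * binom p q′) (+-suc n k) (cancel (+ n) (+ e)))
          (trans (cong (λ q → X * binom (+ e - 1ℤ) q) lower) (vanish e e≤1 k≤2n+e))
    where
    X q q′ : ℤ
    X = ballot (n ℕ.+ k) n
    q = + k - + 2 * + n
    q′ = + suc k - + 2 * + n - 1ℤ
    cancel : ∀ a c → a - a - 1ℤ + c ≡ c - 1ℤ
    cancel = solve-∀
    lower : q′ ≡ q
    lower = shift (+ k) (+ n)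
      where
      shift : ∀ a b → 1ℤ + a - + 2 * b - 1ℤ ≡ a - + 2 * b
      shift = solve-∀
    vanish : ∀ e → e ≤ 1 → k ≤ 2 ℕ.* n ℕ.+ e → X * binom (+ e - 1ℤ) q ≡ 0ℤ
    vanish zero          _        _ = *-zeroʳ X
    vanish (suc (suc e)) (s≤s ()) _
    vanish (suc zero)    _        k≤2n+1 with m≤n⇒m<n∨m≡n k≤2n+1
    ... | inj₂ refl = trans (cong (λ q → X * binom (+ 0) q) q≡1) (*-zeroʳ X)
      where
      q≡1 : + (2 ℕ.* n ℕ.+ 1) - + 2 * + n ≡ 1ℤ
      q≡1 = trans (cong (λ d → + (2 ℕ.* n) + 1ℤ - d) (sym (pos-* 2 n))) (cancel′ (+ (2 ℕ.* n)))
        where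
        cancel′ : ∀ a → a + 1ℤ - a ≡ 1ℤ
        cancel′ = solve-∀
    ... | inj₁ k<2n+1 with diagonal-cases n k 1≤k (≤-pred (subst (suc k ≤_) (ℕ.+-comm (2 ℕ.* n) 1) k<2n+1))
    ...   | inj₁ (r , q≡) = trans (cong (λ q → X * binom (+ 0) q) q≡) (*-zeroʳ X)
    ...   | inj₂ (_ , X≡0) = cong (_* binom (+ 0) q) X≡0

  formula-pascal : ∀ e n k → e ≤ 1 → 1 ≤ k → k ≤ 2 ℕ.* n ℕ.+ e →
    formula e (suc n) (suc k) ≡ formula e (suc n) k + formula e n (suc k)
  formula-pascal e n k e≤1 1≤k k≤2n+e = i-j≡0⇒i≡j _ _ (begin
    t₁ (suc n) - (t₂ (suc n) + formula e n (suc k))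
      ≡⟨ cong (λ z → t₁ (suc n) - (t₂ (suc n) + z)) extend ⟩
    t₁ (suc n) - (t₂ (suc n) + t₃ (suc n))
      ≡⟨ assoc (t₁ (suc n)) (t₂ (suc n)) (t₃ (suc n)) ⟩
    t₁ (suc n) - t₂ (suc n) - t₃ (suc n)
      ≡⟨ cong (_- t₃ (suc n)) (∑-distrib-- (suc n) (term e (suc n) (suc k)) (term e (suc n) k)) ⟨
    ∑[ m < suc n ] (term e (suc n) (suc k) m - term e (suc n) k m) - t₃ (suc n)
      ≡⟨ ∑-distrib-- (suc n) _ (term e n (suc k)) ⟨
    ∑[ m < suc n ] (term e (suc n) (suc k) m - term e (suc n) k m - term e n (suc k) m)
      ≡⟨ ∑-cong (suc n) (λ m m<1+n → term-difference e n k m 1≤k k≤2n+e (≤-pred m<1+n)) ⟩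
    ∑[ m < suc n ] (telescopeTerm e n k m - telescopeTerm e n k (suc m))
      ≡⟨ ∑-telescope (suc n) (telescopeTerm e n k) ⟩
    0ℤ - telescopeTerm e n k (suc n)
      ≡⟨ cong (_-_ 0ℤ) (telescopeTerm-last≡0 e n k e≤1 k≤2n+e) ⟩
    0ℤ ∎)
    where
    open ≡-Reasoning
    t₁ t₂ t₃ : ℕ → ℤ
    t₁ N = ∑[ m < N ] term e (suc n) (suc k) m
    t₂ N = ∑[ m < N ] term e (suc n) k m
    t₃ N = ∑[ m < N ] term e n (suc k) m
    extend : formula e n (suc k) ≡ t₃ (suc n)
    extend = sym (trans (cong (_+_ (t₃ n)) (term-last≡0 e n k e≤1 1≤k k≤2n+e)) (+-identityʳ (t₃ n)))
    assoc : ∀ a b c → a - (b + c) ≡ a - b - c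
    assoc = solve-∀

module ClosedForm where

  open import Data.Nat as ℕ using (ℕ; zero; suc; _≤_; _<_; _%_; _≡ᵇ_; ⌊_/2⌋; z≤n; s≤s)
  open import Data.Nat.Properties as ℕ using (≤-trans; ≤-pred; ≤-reflexive; n≤1+n)
  open import Data.Nat.DivMod using (m%n<n)
  import Data.Nat.Tactic.RingSolver as ℕ-Solver
  open import Data.Integer using (ℤ; 0ℤ; 1ℤ; _+_)
  open import Data.Integer.Properties using (+-identityˡ)
  open import Data.Product using (_×_; _,_)
  open import Relation.Binary.PropositionalEquality
  open Sum
  open Formula

  -- closedForm m k is the paper's right-hand side for j^last_{m,k} when m ≥ 2.
  closedForm : ℕ → ℕ → ℤ
  closedForm zero          k = 0ℤ
  closedForm (suc zero)    k = 𝟙 (k ≡ᵇ 1)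
  closedForm (suc (suc m)) k = formula (m % 2) (suc ⌊ m /2⌋) k

  2[1+n]+e : ∀ n e → 2 ℕ.* suc n ℕ.+ e ≡ suc (suc (2 ℕ.* n ℕ.+ e))
  2[1+n]+e = ℕ-Solver.solve-∀

  2*⌊n/2⌋+n%2≡n : ∀ n → 2 ℕ.* ⌊ n /2⌋ ℕ.+ n % 2 ≡ n
  2*⌊n/2⌋+n%2≡n zero          = refl
  2*⌊n/2⌋+n%2≡n (suc zero)    = refl
  2*⌊n/2⌋+n%2≡n (suc (suc n)) = trans (2[1+n]+e ⌊ n /2⌋ (n % 2)) (cong (λ m → suc (suc m)) (2*⌊n/2⌋+n%2≡n n))

  n%2≤1 : ∀ n → n % 2 ≤ 1
  n%2≤1 n = ≤-pred (m%n<n n 2)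

  closedForm-0 : ∀ m → closedForm m 0 ≡ 0ℤ
  closedForm-0 zero          = refl
  closedForm-0 (suc zero)    = refl
  closedForm-0 (suc (suc m)) = formula-0 (m % 2) (suc ⌊ m /2⌋)

  closedForm-1 : ∀ m → closedForm (suc m) 1 ≡ 1ℤ
  closedForm-1 zero     = refl
  closedForm-1 (suc m)  = formula-1 (m % 2) ⌊ m /2⌋

  closedForm-above : ∀ m k → 2 ≤ m → m ≤ k → closedForm m k ≡ 0ℤ
  closedForm-above (suc zero)    k (s≤s ()) _
  closedForm-above (suc (suc m)) k _ m+2≤k =
    formula-above (m % 2) (suc ⌊ m /2⌋) k (≤-trans (≤-reflexive (2*⌊n/2⌋+n%2≡n (suc (suc m)))) m+2≤k)

  closedForm->m : ∀ m k → m < k → closedForm m k ≡ 0ℤ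
  closedForm->m zero                k          _           = refl
  closedForm->m (suc zero)          (suc (suc k)) _        = refl
  closedForm->m (suc zero)          (suc zero) (s≤s ())
  closedForm->m m@(suc (suc _))     k          m<k         = closedForm-above m k (s≤s (s≤s z≤n)) (ℕ.<⇒≤ m<k)

  closedForm-pascal : ∀ m k → 1 ≤ m → 1 ≤ k → k ≤ m →
    closedForm (suc (suc m)) (suc k) ≡ closedForm (suc (suc m)) k + closedForm m (suc k)
  closedForm-pascal m k 1≤m 1≤k k≤m =
    trans (formula-pascal (m % 2) ⌊ m /2⌋ k (n%2≤1 m) 1≤k (≤-trans k≤m (≤-reflexive (sym (2*⌊n/2⌋+n%2≡n m)))))
          (cong (closedForm (suc (suc m)) k +_) (smaller m 1≤m))
    where
    smaller : ∀ m → 1 ≤ m → formula (m % 2) ⌊ m /2⌋ (suc k) ≡ closedForm m (suc k)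
    smaller (suc zero)    _ = sym (closedForm->m 1 (suc k) (s≤s 1≤k))
    smaller (suc (suc m)) _ = refl

  closedForm-prefix : ∀ m k → 1 ≤ m → k ≤ suc m → closedForm (suc (suc m)) k ≡ ∑[ j < suc k ] closedForm m j
  closedForm-prefix m zero          _   _ = trans (closedForm-0 (suc (suc m))) (sym (trans (+-identityˡ _) (closedForm-0 m)))
  closedForm-prefix (suc m) (suc zero) _ _ =
    trans (closedForm-1 (suc (suc m))) (sym (cong₂ _+_ (trans (+-identityˡ _) (closedForm-0 (suc m))) (closedForm-1 m)))
  closedForm-prefix m (suc (suc k)) 1≤m k+2≤m+1 =
    trans (closedForm-pascal m (suc k) 1≤m (s≤s z≤n) (≤-pred k+2≤m+1))
          (cong (_+ closedForm m (suc (suc k))) (closedForm-prefix m (suc k) 1≤m (≤-trans (n≤1+n (suc k)) k+2≤m+1)))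

  2*n+e-halves : ∀ n e → e ≤ 1 → (2 ℕ.* n ℕ.+ e) % 2 ≡ e × ⌊ 2 ℕ.* n ℕ.+ e /2⌋ ≡ n
  2*n+e-halves zero    zero          _ = refl , refl
  2*n+e-halves zero    (suc zero)    _ = refl , refl
  2*n+e-halves zero    (suc (suc e)) (s≤s ())
  2*n+e-halves (suc n) e e≤1 with 2*n+e-halves n e e≤1
  ... | parity , half = trans (cong (_% 2) (2[1+n]+e n e)) parity , trans (cong ⌊_/2⌋ (2[1+n]+e n e)) (cong suc half)

  closedForm-2n+e : ∀ n e k → e ≤ 1 → closedForm (2 ℕ.* suc n ℕ.+ e) k ≡ formula e (suc n) k
  closedForm-2n+e n e k e≤1 with 2*n+e-halves n e e≤1
  ... | parity , half = trans (cong (λ m → closedForm m k) (2[1+n]+e n e)) (cong₂ (λ p h → formula p (suc h) k) parity half)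

module Convolution where

  open import Data.Bool using (Bool; _∨_)
  open import Data.Nat as ℕ using (ℕ; zero; suc; _≤_; _<_; _∸_; _%_; _≡ᵇ_; z≤n; s≤s)
  open import Data.Nat.Properties as ℕ using (≤-trans; ≤-pred; ≤-refl; ≤-reflexive; m≤n⇒m≤1+n; +-∸-assoc; m∸n≤m)
  open import Data.Integer using (ℤ; 0ℤ; 1ℤ; _+_; _*_)
  open import Data.Integer.Properties using (+-identityˡ; +-identityʳ; *-zeroʳ; *-identityˡ; *-identityʳ)
  open import Relation.Binary.Definitions using (tri<; tri≈; tri>)
  open import Relation.Binary.PropositionalEquality
  open Sum
  open ClosedForm

  total : (ℕ → ℕ → ℤ) → ℕ → ℤ
  total F zero    = 1ℤ
  total F (suc i) = ∑[ j < suc (suc i) ] F (suc i) j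

  -- Whether α (m + 1) β with |α| = i, |β| = b can be Jacobi: the last letter of α has run 1 + b.
  gluableᵇ : ℕ → ℕ → Bool
  gluableᵇ i b = (i ≡ᵇ 0) ∨ (b % 2 ≡ᵇ 1)

  convolve : (ℕ → ℕ → ℤ) → ℕ → ℕ → ℤ
  convolve F m k = ∑[ i < suc m ] (𝟙 (gluableᵇ i (m ∸ i)) * (total F i * F (m ∸ i) (k ∸ i)))

  private
    R : ℕ → ℕ → ℤ
    R = closedForm

    c : ℕ → ℕ → ℤ
    c i b = 𝟙 (gluableᵇ i b)

    gated-prefix : ∀ i b k → 1 ≤ i ℕ.+ b → k ≤ suc b →
      c i b * (total R i * ∑[ j < suc k ] R b j) ≡ c i b * (total R i * R (suc (suc b)) k)
    gated-prefix zero    zero    k ()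
    gated-prefix (suc i) zero    k _ _   = refl
    gated-prefix i       (suc b) k _ k≤ =
      cong (λ x → c i (suc b) * (total R i * x)) (sym (closedForm-prefix (suc b) k (s≤s z≤n) k≤))

  module _ (m : ℕ) (1≤m : 1 ≤ m) (IH : ∀ j → R (suc m) j ≡ convolve R m j) where

    private
      summand : ℕ → ℕ → ℤ
      summand k i = c i (suc (suc m) ∸ i) * (total R i * R (suc (suc m) ∸ i) (k ∸ i))

      summand≡0 : ∀ k i → R (suc (suc m) ∸ i) (k ∸ i) ≡ 0ℤ → summand k i ≡ 0ℤ
      summand≡0 k i R≡0 = trans (cong (λ x → c i (suc (suc m) ∸ i) * (total R i * x)) R≡0)
                                (trans (cong (c i (suc (suc m) ∸ i) *_) (*-zeroʳ (total R i))) (*-zeroʳ (c i (suc (suc m) ∸ i))))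

      convolve-split : ∀ k → convolve R (suc (suc m)) k ≡ ∑[ i < suc m ] summand k i + total R (suc m) * R 1 (k ∸ suc m)
      convolve-split k = begin
        ∑[ i < suc m ] summand k i + summand k (suc m) + summand k (suc (suc m))
          ≡⟨ cong (_+_ (∑[ i < suc m ] summand k i + summand k (suc m))) last≡0 ⟩
        ∑[ i < suc m ] summand k i + summand k (suc m) + 0ℤ
          ≡⟨ +-identityʳ _ ⟩
        ∑[ i < suc m ] summand k i + summand k (suc m)
          ≡⟨ cong (_+_ (∑[ i < suc m ] summand k i)) penultimate ⟩
        ∑[ i < suc m ] summand k i + total R (suc m) * R 1 (k ∸ suc m) ∎
        where
        open ≡-Reasoning
        last≡0 : summand k (suc (suc m)) ≡ 0ℤ
        last≡0 = summand≡0 k (suc (suc m)) (cong (λ b → R b (k ∸ suc (suc m))) (ℕ.n∸n≡0 (suc (suc m))))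
        penultimate : summand k (suc m) ≡ total R (suc m) * R 1 (k ∸ suc m)
        penultimate = trans (cong (λ b → c (suc m) b * (total R (suc m) * R b (k ∸ suc m))) (ℕ.m+n∸n≡m 1 m)) (*-identityˡ _)

      pull : ∀ a b N (g : ℕ → ℤ) → ∑[ j < N ] (a * (b * g j)) ≡ a * (b * ∑ N g)
      pull a b N g = trans (∑-distribˡ-* N a (λ j → b * g j)) (cong (a *_) (∑-distribˡ-* N b g))

      convolve-below : ∀ k → k ≤ suc m → R (suc (suc (suc m))) k ≡ convolve R (suc (suc m)) k
      convolve-below k k≤1+m = begin
        R (suc (suc (suc m))) k
          ≡⟨ closedForm-prefix (suc m) k (s≤s z≤n) (m≤n⇒m≤1+n k≤1+m) ⟩
        ∑[ j < suc k ] R (suc m) j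
          ≡⟨ ∑-cong (suc k) (λ j _ → IH j) ⟩
        ∑[ j < suc k ] ∑[ i < suc m ] (c i (m ∸ i) * (total R i * R (m ∸ i) (j ∸ i)))
          ≡⟨ ∑-comm (suc k) (suc m) (λ i j → c i (m ∸ i) * (total R i * R (m ∸ i) (j ∸ i))) ⟩
        ∑[ i < suc m ] ∑[ j < suc k ] (c i (m ∸ i) * (total R i * R (m ∸ i) (j ∸ i)))
          ≡⟨ ∑-cong (suc m) (λ i i<1+m → regroup i (≤-pred i<1+m)) ⟩
        ∑[ i < suc m ] summand k i
          ≡⟨ +-identityʳ _ ⟨
        ∑[ i < suc m ] summand k i + 0ℤ
          ≡⟨ cong (_+_ (∑[ i < suc m ] summand k i)) last≡0 ⟨
        ∑[ i < suc m ] summand k i + total R (suc m) * R 1 (k ∸ suc m)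
          ≡⟨ convolve-split k ⟨
        convolve R (suc (suc m)) k ∎
        where
        open ≡-Reasoning
        last≡0 : total R (suc m) * R 1 (k ∸ suc m) ≡ 0ℤ
        last≡0 = trans (cong (λ j → total R (suc m) * R 1 j) (ℕ.m≤n⇒m∸n≡0 k≤1+m)) (*-zeroʳ (total R (suc m)))
        regroup : ∀ i → i ≤ m → ∑[ j < suc k ] (c i (m ∸ i) * (total R i * R (m ∸ i) (j ∸ i))) ≡ summand k i
        regroup i i≤m = begin
          ∑[ j < suc k ] (c i (m ∸ i) * (total R i * R (m ∸ i) (j ∸ i)))
            ≡⟨ pull (c i (m ∸ i)) (total R i) (suc k) (λ j → R (m ∸ i) (j ∸ i)) ⟩
          c i (m ∸ i) * (total R i * ∑[ j < suc k ] R (m ∸ i) (j ∸ i))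
            ≡⟨ cong (λ x → c i (m ∸ i) * (total R i * x)) (∑-∸-shift (R (m ∸ i)) i k (closedForm-0 (m ∸ i))) ⟩
          c i (m ∸ i) * (total R i * ∑[ j < suc (k ∸ i) ] R (m ∸ i) j)
            ≡⟨ gated-prefix i (m ∸ i) (k ∸ i) (≤-trans 1≤m (≤-reflexive (sym (ℕ.m+[n∸m]≡n i≤m))))
                 (≤-trans (ℕ.∸-monoˡ-≤ i k≤1+m) (≤-reflexive (+-∸-assoc 1 i≤m))) ⟩
          c i (m ∸ i) * (total R i * R (suc (suc (m ∸ i))) (k ∸ i))
            ≡⟨ cong (λ b → c i b * (total R i * R b (k ∸ i))) (+-∸-assoc 2 i≤m) ⟨
          summand k i ∎

      convolve-diagonal : R (suc (suc (suc m))) (suc (suc m)) ≡ convolve R (suc (suc m)) (suc (suc m))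
      convolve-diagonal = begin
        R (suc (suc (suc m))) (suc (suc m))
          ≡⟨ closedForm-prefix (suc m) (suc (suc m)) (s≤s z≤n) ≤-refl ⟩
        total R (suc m) + R (suc m) (suc (suc m))
          ≡⟨ cong (_+_ (total R (suc m))) (closedForm->m (suc m) (suc (suc m)) ≤-refl) ⟩
        total R (suc m) + 0ℤ
          ≡⟨ +-identityʳ _ ⟩
        total R (suc m)
          ≡⟨ *-identityʳ (total R (suc m)) ⟨
        total R (suc m) * R 1 1
          ≡⟨ cong (λ j → total R (suc m) * R 1 j) (ℕ.m+n∸n≡m 1 m) ⟨
        total R (suc m) * R 1 (suc (suc m) ∸ suc m)
          ≡⟨ +-identityˡ _ ⟨
        0ℤ + total R (suc m) * R 1 (suc (suc m) ∸ suc m)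
          ≡⟨ cong (_+ total R (suc m) * R 1 (suc (suc m) ∸ suc m)) (∑-zero (suc m) vanish) ⟨
        ∑[ i < suc m ] summand (suc (suc m)) i + total R (suc m) * R 1 (suc (suc m) ∸ suc m)
          ≡⟨ convolve-split (suc (suc m)) ⟨
        convolve R (suc (suc m)) (suc (suc m)) ∎
        where
        open ≡-Reasoning
        vanish : ∀ i → i < suc m → summand (suc (suc m)) i ≡ 0ℤ
        vanish i (s≤s i≤m) = summand≡0 (suc (suc m)) i
          (trans (cong (λ b → R b b) (+-∸-assoc 2 i≤m)) (closedForm-above (suc (suc (m ∸ i))) _ (s≤s (s≤s z≤n)) ≤-refl))

      convolve-above : ∀ k → suc (suc m) < k → R (suc (suc (suc m))) k ≡ convolve R (suc (suc m)) k
      convolve-above k m+2<k = trans (closedForm-above _ k (s≤s (s≤s z≤n)) m+2<k) (sym (∑-zero (suc (suc (suc m))) vanish))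
        where
        vanish : ∀ i → i < suc (suc (suc m)) → summand k i ≡ 0ℤ
        vanish i i<m+3 = summand≡0 k i (closedForm->m _ _ (ℕ.∸-monoˡ-< m+2<k (≤-pred i<m+3)))

    convolve-step : ∀ k → R (suc (suc (suc m))) k ≡ convolve R (suc (suc m)) k
    convolve-step k with ℕ.<-cmp k (suc (suc m))
    ... | tri< k<m+2 _ _ = convolve-below k (≤-pred k<m+2)
    ... | tri≈ _ refl _  = convolve-diagonal
    ... | tri> _ _ m+2<k = convolve-above k m+2<k

  closedForm-convolve : ∀ m k → 1 ≤ m → closedForm (suc m) k ≡ convolve closedForm m k
  closedForm-convolve (suc zero)          zero                   _ = refl
  closedForm-convolve (suc zero)          (suc zero)             _ = refl
  closedForm-convolve (suc zero)          (suc (suc k))          _ = refl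
  closedForm-convolve (suc (suc zero))    zero                   _ = refl
  closedForm-convolve (suc (suc zero))    (suc zero)             _ = refl
  closedForm-convolve (suc (suc zero))    (suc (suc zero))       _ = refl
  closedForm-convolve (suc (suc zero))    (suc (suc (suc k)))    _ = refl
  closedForm-convolve (suc (suc (suc m))) k                      _ =
    convolve-step (suc m) (s≤s z≤n) (λ j → closedForm-convolve (suc m) j (s≤s z≤n)) k

  convolve-cong : ∀ {F G} m k → (∀ b → b ≤ m → ∀ j → F b j ≡ G b j) → convolve F m k ≡ convolve G m k
  convolve-cong {F} {G} m k F≡G = ∑-cong (suc m) λ i i<1+m →
    cong₂ (λ t x → 𝟙 (gluableᵇ i (m ∸ i)) * (t * x)) (total-cong i (≤-pred i<1+m)) (F≡G (m ∸ i) (m∸n≤m m i) (k ∸ i))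
    where
    total-cong : ∀ i → i ≤ m → total F i ≡ total G i
    total-cong zero    _   = refl
    total-cong (suc i) i≤m = ∑-cong (suc (suc i)) (λ j _ → F≡G (suc i) i≤m j)

module Words where

  open import Data.Bool using (true; false)
  open import Data.Nat using (ℕ; zero; suc; _+_; _∸_; _<_; _≤_; _<ᵇ_; _%_; s≤s)
  open import Data.Nat.Properties using (<-asym; <⇒≤; +-monoʳ-<; m≤m+n; m+n∸m≡n; ∸-monoˡ-<)
  open import Data.Nat.DivMod using (%-distribˡ-+)
  open import Data.List using (List; []; _∷_; _++_; map; length)
  open import Data.List.Properties using (map-∘; map-cong; map-id)
  open import Data.List.Relation.Unary.All using (All; []; _∷_; tabulate; lookup)
  open import Data.List.Membership.Propositional using (_∈_)
  open import Data.List.Membership.Propositional.Properties using (∈-++⁻; ∈-map⁻)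
  open import Data.List.Relation.Unary.Any using (here; there)
  open import Data.List.Relation.Binary.Sublist.Propositional using (_⊆_; _∷_; _∷ʳ_; ⊆-refl; ⊆-trans; to∈; from∈)
  open import Data.List.Relation.Binary.Sublist.Propositional.Properties using (∷ˡ⁻; ++⁺; map⁺)
  open import Data.Product using (_×_; _,_; proj₁; proj₂)
  open import Data.Sum using (_⊎_; inj₁; inj₂; map₁)
  open import Data.Unit using (tt)
  open import Relation.Binary.PropositionalEquality
  open import Defs using (runLen; Jacobi; Avoids231)

  glue : ℕ → ℕ → List ℕ → List ℕ → List ℕ
  glue x i α β = α ++ x ∷ map (i +_) β

  [i+y]<ᵇ[i+z]≡y<ᵇz : ∀ i y z → (i + y <ᵇ i + z) ≡ (y <ᵇ z)
  [i+y]<ᵇ[i+z]≡y<ᵇz zero    y z = refl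
  [i+y]<ᵇ[i+z]≡y<ᵇz (suc i) y z = [i+y]<ᵇ[i+z]≡y<ᵇz i y z

  <⇒<ᵇ≡true : ∀ {m n} → m < n → (m <ᵇ n) ≡ true
  <⇒<ᵇ≡true {zero}  {suc n} _         = refl
  <⇒<ᵇ≡true {suc m} {suc n} (s≤s m<n) = <⇒<ᵇ≡true m<n

  ≤⇒<ᵇ≡false : ∀ {m n} → n ≤ m → (m <ᵇ n) ≡ false
  ≤⇒<ᵇ≡false {m}     {zero}  _         = refl
  ≤⇒<ᵇ≡false {suc m} {suc n} (s≤s n≤m) = ≤⇒<ᵇ≡false n≤m

  runLen-above : ∀ {y} t → All (y <_) t → runLen y t ≡ length t
  runLen-above []      []          = refl
  runLen-above (z ∷ t) (y<z ∷ y<t) rewrite <⇒<ᵇ≡true y<z = cong suc (runLen-above t y<t)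

  runLen-below : ∀ {y} t → All (_< y) t → runLen y t ≡ 0
  runLen-below     []      []        = refl
  runLen-below {y} (z ∷ t) (z<y ∷ _) rewrite ≤⇒<ᵇ≡false {y} {z} (<⇒≤ z<y) = refl

  runLen-map-+ : ∀ i y ys → runLen (i + y) (map (i +_) ys) ≡ runLen y ys
  runLen-map-+ i y []       = refl
  runLen-map-+ i y (z ∷ ys) rewrite [i+y]<ᵇ[i+z]≡y<ᵇz i y z with y <ᵇ z
  ... | true  = cong suc (runLen-map-+ i y ys)
  ... | false = refl

  suc-%2-cong : ∀ {a b} → a % 2 ≡ b % 2 → suc a % 2 ≡ suc b % 2
  suc-%2-cong {a} {b} eq = trans (%-distribˡ-+ 1 a 2) (trans (cong (λ r → (1 + r) % 2) eq) (sym (%-distribˡ-+ 1 b 2)))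

  -- Appending letters that all exceed y changes the run of y by 0 or by their number.
  runLen-++-%2 : ∀ {y} r t → All (y <_) t → length t % 2 ≡ 0 → runLen y (r ++ t) % 2 ≡ runLen y r % 2
  runLen-++-%2     []      t y<t even = trans (cong (_% 2) (runLen-above t y<t)) even
  runLen-++-%2 {y} (z ∷ r) t y<t even with y <ᵇ z
  ... | true  = suc-%2-cong {runLen y (r ++ t)} {runLen y r} (runLen-++-%2 r t y<t even)
  ... | false = refl

  Below : List ℕ → List ℕ → Set
  Below α t = ∀ {a c} → a ∈ α → c ∈ t → a < c

  private
    head-below : ∀ {y α t} → Below (y ∷ α) t → All (y <_) t
    head-below α<t = tabulate (α<t (here refl))

    tail-below : ∀ {y α t} → Below (y ∷ α) t → Below α t
    tail-below α<t a∈α = α<t (there a∈α)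

  Jacobi-++⁺ : ∀ α {t} → Below α t → length t % 2 ≡ 0 → Jacobi α → Jacobi t → Jacobi (α ++ t)
  Jacobi-++⁺ []      _   _    _         jt = jt
  Jacobi-++⁺ (y ∷ α) α<t even (jy , jα) jt =
    trans (runLen-++-%2 α _ (head-below α<t) even) jy , Jacobi-++⁺ α (tail-below α<t) even jα jt

  Jacobi-++⁻ : ∀ α {t} → Below α t → length t % 2 ≡ 0 → Jacobi (α ++ t) → Jacobi α × Jacobi t
  Jacobi-++⁻ []      _   _    j        = tt , j
  Jacobi-++⁻ (y ∷ α) α<t even (jy , j) with Jacobi-++⁻ α (tail-below α<t) even j
  ... | jα , jt = (trans (sym (runLen-++-%2 α _ (head-below α<t) even)) jy , jα) , jt

  -- The run of the last letter of α is all of t.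
  Jacobi-++⇒even : ∀ y α {t} → Below (y ∷ α) t → Jacobi (y ∷ α ++ t) → length t % 2 ≡ 0
  Jacobi-++⇒even y []      α<t (jy , _) = trans (cong (_% 2) (sym (runLen-above _ (head-below α<t)))) jy
  Jacobi-++⇒even y (z ∷ α) α<t (_ , j)  = Jacobi-++⇒even z α (tail-below α<t) j

  Jacobi-∷-max : ∀ {x} β → All (_< x) β → Jacobi β → Jacobi (x ∷ β)
  Jacobi-∷-max β β<x jβ = cong (_% 2) (runLen-below β β<x) , jβ

  Jacobi-map-+⁺ : ∀ i β → Jacobi β → Jacobi (map (i +_) β)
  Jacobi-map-+⁺ i []      _        = tt
  Jacobi-map-+⁺ i (y ∷ β) (jy , j) = trans (cong (_% 2) (runLen-map-+ i y β)) jy , Jacobi-map-+⁺ i β j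

  Jacobi-map-+⁻ : ∀ i β → Jacobi (map (i +_) β) → Jacobi β
  Jacobi-map-+⁻ i []      _        = tt
  Jacobi-map-+⁻ i (y ∷ β) (jy , j) = trans (cong (_% 2) (sym (runLen-map-+ i y β))) jy , Jacobi-map-+⁻ i β j

  Avoids231-⊆ : ∀ {xs ys} → ys ⊆ xs → Avoids231 xs → Avoids231 ys
  Avoids231-⊆ ys⊆xs av (a , b , c , p , c<a , a<b) = av (a , b , c , ⊆-trans p ys⊆xs , c<a , a<b)

  Avoids231-∷-max : ∀ {x} β → All (_< x) β → Avoids231 β → Avoids231 (x ∷ β)
  Avoids231-∷-max β β<x av (a , b , c , (_ ∷ʳ p)  , c<a , a<b) = av (a , b , c , p , c<a , a<b)
  Avoids231-∷-max β β<x av (a , b , c , (refl ∷ p) , c<a , a<b) = <-asym a<b (lookup β<x (to∈ p))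

  pair-⊆-++⁻ : ∀ (α : List ℕ) {t : List ℕ} {b c : ℕ} → (b ∷ c ∷ []) ⊆ α ++ t → (b ∷ c ∷ []) ⊆ α ⊎ c ∈ t
  pair-⊆-++⁻ []      p          = inj₂ (to∈ (∷ˡ⁻ p))
  pair-⊆-++⁻ (y ∷ α) (_ ∷ʳ p)   = map₁ (y ∷ʳ_) (pair-⊆-++⁻ α p)
  pair-⊆-++⁻ (y ∷ α) (refl ∷ p) = map₁ (λ c∈α → refl ∷ from∈ c∈α) (∈-++⁻ α (to∈ p))

  Avoids231-++ : ∀ α {t} → Below α t → Avoids231 α → Avoids231 t → Avoids231 (α ++ t)
  Avoids231-++ []      α<t avα avt pat = avt pat
  Avoids231-++ (y ∷ α) α<t avα avt (a , b , c , (_ ∷ʳ p) , c<a , a<b) =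
    Avoids231-++ α (tail-below α<t) (Avoids231-⊆ (y ∷ʳ ⊆-refl) avα) avt (a , b , c , p , c<a , a<b)
  Avoids231-++ (y ∷ α) α<t avα avt (a , b , c , (refl ∷ p) , c<a , a<b) with pair-⊆-++⁻ α p
  ... | inj₁ p′  = avα (a , b , c , refl ∷ p′ , c<a , a<b)
  ... | inj₂ c∈t = <-asym c<a (α<t (here refl) c∈t)

  Avoids231-map-+⁻ : ∀ i β → Avoids231 (map (i +_) β) → Avoids231 β
  Avoids231-map-+⁻ i β av (a , b , c , p , c<a , a<b) =
    av (i + a , i + b , i + c , map⁺ (i +_) p , +-monoʳ-< i c<a , +-monoʳ-< i a<b)

  Avoids231-map-+⁺ : ∀ i β → Avoids231 β → Avoids231 (map (i +_) β)
  Avoids231-map-+⁺ i β av (a , b , c , p , c<a , a<b) =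
    av (a ∸ i , b ∸ i , c ∸ i , subst (_ ⊆_) undo (map⁺ (_∸ i) p) ,
        ∸-monoˡ-< c<a (i≤ (to∈ (∷ˡ⁻ (∷ˡ⁻ p)))) , ∸-monoˡ-< a<b (i≤ (to∈ p)))
    where
    undo : map (_∸ i) (map (i +_) β) ≡ β
    undo = trans (sym (map-∘ β)) (trans (map-cong (m+n∸m≡n i) β) (map-id β))
    i≤ : ∀ {x} → x ∈ map (i +_) β → i ≤ x
    i≤ x∈ with ∈-map⁻ (i +_) x∈
    ... | z , _ , refl = m≤m+n i z

  231-around : ∀ {a c x : ℕ} α t → a ∈ α → c ∈ t → (a ∷ x ∷ c ∷ []) ⊆ α ++ x ∷ t
  231-around α t a∈α c∈t = ++⁺ (from∈ a∈α) (refl ∷ from∈ c∈t)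

  Jacobi-around⁺ : ∀ α {x t} → Below α (x ∷ t) → All (_< x) t → α ≡ [] ⊎ suc (length t) % 2 ≡ 0 →
    Jacobi α → Jacobi t → Jacobi (α ++ x ∷ t)
  Jacobi-around⁺ []      _   t<x _            _  jt = Jacobi-∷-max _ t<x jt
  Jacobi-around⁺ (y ∷ α) α<t t<x (inj₂ even) jα jt = Jacobi-++⁺ (y ∷ α) α<t even jα (Jacobi-∷-max _ t<x jt)

  Jacobi-around⁻ : ∀ α {x t} → Below α (x ∷ t) → Jacobi (α ++ x ∷ t) →
    Jacobi α × Jacobi t × (α ≡ [] ⊎ suc (length t) % 2 ≡ 0)
  Jacobi-around⁻ []      _   (_ , jt) = tt , jt , inj₁ refl
  Jacobi-around⁻ (y ∷ α) {x} {t} α<t j = proj₁ split , proj₂ (proj₂ split) , inj₂ even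
    where
    even : suc (length t) % 2 ≡ 0
    even = Jacobi-++⇒even y α α<t j
    split : Jacobi (y ∷ α) × Jacobi (x ∷ t)
    split = Jacobi-++⁻ (y ∷ α) α<t even j

module Permutations where

  open import Data.Nat using (ℕ; zero; suc; _+_; _<_; _≤_; _≤?_; _<?_; s≤s; z≤n)
  open import Data.Nat.Properties using (suc-injective; <⇒≢; <⇒≱; ≤⇒≯; +-suc)
  open import Data.List using ([]; _∷_; _++_; map; length; applyUpTo; upTo; filter)
  open import Data.List.Properties using (map-applyUpTo; map-upTo; map-cong; length-applyUpTo; filter-++; filter-all; filter-none; ++-identityʳ)
  open import Data.List.Relation.Unary.All as All using (All)
  open import Data.List.Relation.Unary.Unique.Propositional using (Unique)
  open import Data.List.Relation.Unary.Unique.Propositional.Properties using (applyUpTo⁺₁)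
  open import Data.List.Membership.Propositional using (_∈_)
  open import Data.List.Membership.Propositional.Properties using (∈-applyUpTo⁺; ∈-applyUpTo⁻)
  open import Data.List.Relation.Binary.Permutation.Propositional using (↭-sym; ↭⇒↭ₛ)
  import Data.List.Relation.Binary.Permutation.Propositional.Properties as ↭
  import Data.List.Relation.Binary.Permutation.Setoid.Properties as ↭ₛ
  open import Data.Product using (_×_; _,_)
  open import Relation.Binary.PropositionalEquality using (_≡_; refl; sym; trans; cong; cong₂; setoid; module ≡-Reasoning)
  open import Function using (_∘′_)
  open import Defs using (range1; IsPerm)

  applyUpTo-++ : ∀ (f : ℕ → ℕ) i b → applyUpTo f (i + b) ≡ applyUpTo f i ++ applyUpTo (λ x → f (i + x)) b
  applyUpTo-++ f zero    b = refl
  applyUpTo-++ f (suc i) b = cong (f 0 ∷_) (applyUpTo-++ (λ x → f (suc x)) i b)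

  range1-++ : ∀ i b → range1 (i + b) ≡ range1 i ++ map (i +_) (range1 b)
  range1-++ i b = trans (applyUpTo-++ suc i b) (cong (range1 i ++_) (begin
    applyUpTo (λ x → suc (i + x)) b   ≡⟨ map-upTo (λ x → suc (i + x)) b ⟨
    map (λ x → suc (i + x)) (upTo b)  ≡⟨ map-cong (λ x → sym (+-suc i x)) (upTo b) ⟩
    map (λ x → i + suc x) (upTo b)    ≡⟨ map-upTo (λ x → i + suc x) b ⟩
    applyUpTo (λ x → i + suc x) b     ≡⟨ map-applyUpTo suc (i +_) b ⟨
    map (i +_) (range1 b)             ∎))
    where open ≡-Reasoning

  ∈-range1⁻ : ∀ {x m} → x ∈ range1 m → 1 ≤ x × x ≤ m
  ∈-range1⁻ x∈ with ∈-applyUpTo⁻ suc x∈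
  ... | _ , i<m , refl = s≤s z≤n , i<m

  ∈-range1⁺ : ∀ {x m} → 1 ≤ x → x ≤ m → x ∈ range1 m
  ∈-range1⁺ {suc x} _ x<m = ∈-applyUpTo⁺ suc x<m

  IsPerm-∈ : ∀ {m π x} → IsPerm m π → x ∈ π → 1 ≤ x × x ≤ m
  IsPerm-∈ π↭ x∈π = ∈-range1⁻ (↭.∈-resp-↭ π↭ x∈π)

  IsPerm-length : ∀ {m π} → IsPerm m π → length π ≡ m
  IsPerm-length {m} π↭ = trans (↭.↭-length π↭) (length-applyUpTo suc m)

  IsPerm-unique : ∀ {m π} → IsPerm m π → Unique π
  IsPerm-unique {m} π↭ =
    ↭ₛ.Unique-resp-↭ (setoid ℕ) (↭⇒↭ₛ (↭-sym π↭)) (applyUpTo⁺₁ suc m (λ i<j _ → <⇒≢ i<j ∘′ suc-injective))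

  filter-≤-++ : ∀ i {xs ys} → All (_≤ i) xs → All (i <_) ys → filter (_≤? i) (xs ++ ys) ≡ xs
  filter-≤-++ i {xs} {ys} xs≤i i<ys = begin
    filter (_≤? i) (xs ++ ys)               ≡⟨ filter-++ (_≤? i) xs ys ⟩
    filter (_≤? i) xs ++ filter (_≤? i) ys  ≡⟨ cong₂ _++_ (filter-all (_≤? i) xs≤i) (filter-none (_≤? i) (All.map <⇒≱ i<ys)) ⟩
    xs ++ []                                ≡⟨ ++-identityʳ xs ⟩
    xs                                      ∎
    where open ≡-Reasoning

  filter->-++ : ∀ i {xs ys} → All (_≤ i) xs → All (i <_) ys → filter (i <?_) (xs ++ ys) ≡ ys
  filter->-++ i {xs} {ys} xs≤i i<ys = begin
    filter (i <?_) (xs ++ ys)               ≡⟨ filter-++ (i <?_) xs ys ⟩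
    filter (i <?_) xs ++ filter (i <?_) ys  ≡⟨ cong₂ _++_ (filter-none (i <?_) (All.map ≤⇒≯ xs≤i)) (filter-all (i <?_) i<ys) ⟩
    ys                                      ∎
    where open ≡-Reasoning

module Decomposition where

  open import Data.Bool using (true)
  open import Data.Empty using (⊥-elim)
  open import Data.Nat using (ℕ; zero; suc; _+_; _∸_; _<_; _≤_; _≤?_; _<?_; _%_; s≤s; z≤n)
  open import Data.Nat.Properties using (<-cmp; m<m+n; +-monoʳ-≤; ≤-trans; ≤-refl; ≤-reflexive; m+[n∸m]≡n; ≤-<-trans)
  open import Data.List using (List; []; _∷_; _++_; map; length; [_])
  open import Data.List.Properties using (applyUpTo-∷ʳ; length-map; length-applyUpTo; ++-identityʳ)
  open import Data.List.Extrema.Nat using (max; xs≤max; max≤v⁺; max<v⁺)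
  open import Data.List.Relation.Unary.All as All using (All; tabulate)
  open import Data.List.Relation.Unary.Any using (here; there)
  open import Data.List.Relation.Unary.AllPairs using (_∷_)
  open import Data.List.Relation.Unary.Unique.Propositional using (Unique)
  open import Data.List.Membership.Propositional using (_∈_)
  open import Data.List.Membership.Propositional.Properties using (∈-++⁺ˡ; ∈-++⁺ʳ; ∈-map⁻; ∈-∃++)
  open import Data.List.Relation.Binary.Permutation.Propositional using (_↭_; ↭-sym; ↭-trans; ↭-reflexive; module PermutationReasoning)
  import Data.List.Relation.Binary.Permutation.Propositional.Properties as ↭
  open import Data.List.Relation.Binary.Sublist.Propositional using (_∷ʳ_; ⊆-refl)
  open import Data.List.Relation.Binary.Sublist.Propositional.Properties using (++⁺ˡ; ++⁺ʳ)
  open import Data.Product using (∃-syntax; _×_; _,_; proj₁; proj₂)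
  open import Data.Sum using (_⊎_; inj₁; inj₂; map₂)
  open import Relation.Binary.Definitions using (tri<; tri≈; tri>)
  open import Relation.Binary.PropositionalEquality using (_≡_; refl; sym; trans; cong; subst; subst₂)
  open import Relation.Nullary using (¬_)
  open import Defs using (range1; IsPerm; Jacobi; Avoids231)
  open Convolution using (gluableᵇ)
  open Words
  open Permutations

  Jacobi231 : ℕ → List ℕ → Set
  Jacobi231 m π = IsPerm m π × Jacobi π × Avoids231 π

  gluableᵇ⇒odd : ∀ i b → gluableᵇ (suc i) b ≡ true → suc b % 2 ≡ 0
  gluableᵇ⇒odd i (suc zero)    _  = refl
  gluableᵇ⇒odd i (suc (suc b)) ok = gluableᵇ⇒odd i b ok

  odd⇒gluableᵇ : ∀ i b → suc b % 2 ≡ 0 → gluableᵇ i b ≡ true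
  odd⇒gluableᵇ zero    b             _   = refl
  odd⇒gluableᵇ (suc i) (suc zero)    _   = refl
  odd⇒gluableᵇ (suc i) (suc (suc b)) odd = odd⇒gluableᵇ (suc i) b odd

  gluableᵇ⇒around : ∀ i b {α} → IsPerm i α → gluableᵇ i b ≡ true → α ≡ [] ⊎ suc b % 2 ≡ 0
  gluableᵇ⇒around zero    b α↭ _  = inj₁ (↭.↭-empty-inv α↭)
  gluableᵇ⇒around (suc i) b _  ok = inj₂ (gluableᵇ⇒odd i b ok)

  around⇒gluableᵇ : ∀ i b {α} → IsPerm i α → α ≡ [] ⊎ suc b % 2 ≡ 0 → gluableᵇ i b ≡ true
  around⇒gluableᵇ i b α↭ (inj₁ refl) rewrite sym (IsPerm-length α↭) = refl
  around⇒gluableᵇ i b α↭ (inj₂ odd)  = odd⇒gluableᵇ i b odd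

  record Gluing (m : ℕ) (π : List ℕ) : Set where
    constructor gluing
    field
      i     : ℕ
      α β   : List ℕ
      i≤m   : i ≤ m
      ok    : gluableᵇ i (m ∸ i) ≡ true
      α-ok  : Jacobi231 i α
      β-ok  : Jacobi231 (m ∸ i) β
      π≡    : π ≡ glue (suc m) i α β

  glued : ∀ {m π} → Gluing m π → Jacobi231 (suc m) π
  glued {m} (gluing i α β i≤m ok (α↭ , jα , avα) (β↭ , jβ , avβ) refl) = perm , jac , avoid
    where
    x b : ℕ
    x = suc m
    b = m ∸ i
    β′ : List ℕ
    β′ = map (i +_) β
    β′-range : ∀ {z} → z ∈ β′ → i < z × z ≤ m
    β′-range z∈ with ∈-map⁻ (i +_) z∈
    ... | z , z∈β , refl = m<m+n i (proj₁ (IsPerm-∈ β↭ z∈β)) ,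
                           ≤-trans (+-monoʳ-≤ i (proj₂ (IsPerm-∈ β↭ z∈β))) (≤-reflexive (m+[n∸m]≡n i≤m))
    β′<x : All (_< x) β′
    β′<x = tabulate (λ z∈ → s≤s (proj₂ (β′-range z∈)))
    α<xβ′ : Below α (x ∷ β′)
    α<xβ′ a∈ (here refl) = s≤s (≤-trans (proj₂ (IsPerm-∈ α↭ a∈)) i≤m)
    α<xβ′ a∈ (there c∈)  = ≤-<-trans (proj₂ (IsPerm-∈ α↭ a∈)) (proj₁ (β′-range c∈))
    perm : α ++ x ∷ β′ ↭ range1 x
    perm = begin
      α ++ x ∷ β′                                    ↭⟨ ↭.shift x α β′ ⟩
      x ∷ α ++ β′                                    ↭⟨ ↭.∷↭∷ʳ x (α ++ β′) ⟩
      (α ++ β′) ++ [ x ]                             ↭⟨ ↭.++⁺ʳ [ x ] (↭.++⁺ α↭ (↭.map⁺ (i +_) β↭)) ⟩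
      (range1 i ++ map (i +_) (range1 b)) ++ [ x ]   ≡⟨ cong (_++ [ x ]) (trans (sym (range1-++ i b)) (cong range1 (m+[n∸m]≡n i≤m))) ⟩
      range1 m ++ [ x ]                              ≡⟨ applyUpTo-∷ʳ suc m ⟩
      range1 x                                       ∎
      where open PermutationReasoning
    |β′|≡b : length β′ ≡ b
    |β′|≡b = trans (length-map (i +_) β) (IsPerm-length β↭)
    jac : Jacobi (α ++ x ∷ β′)
    jac = Jacobi-around⁺ α α<xβ′ β′<x (map₂ (subst (λ n → suc n % 2 ≡ 0) (sym |β′|≡b)) (gluableᵇ⇒around i b α↭ ok))
                         jα (Jacobi-map-+⁺ i β jβ)
    avoid : Avoids231 (α ++ x ∷ β′)
    avoid = Avoids231-++ α α<xβ′ avα (Avoids231-∷-max β′ β′<x (Avoids231-map-+⁺ i β avβ))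

  Unique-++⇒disjoint : ∀ (α : List ℕ) {t a c} → Unique (α ++ t) → a ∈ α → c ∈ t → ¬ a ≡ c
  Unique-++⇒disjoint (y ∷ α) (y∉ ∷ _) (here refl)  c∈t = All.lookup y∉ (∈-++⁺ʳ α c∈t)
  Unique-++⇒disjoint (y ∷ α) (_ ∷ u)  (there a∈α) c∈t = Unique-++⇒disjoint α u a∈α c∈t

  module Split {m : ℕ} (α β′ : List ℕ) (π↭ : IsPerm (suc m) (α ++ suc m ∷ β′)) (avπ : Avoids231 (α ++ suc m ∷ β′)) where

    rest↭ : α ++ β′ ↭ range1 m
    rest↭ = ↭-trans (↭.drop-mid α (range1 m) (↭-trans π↭ (↭-reflexive (sym (applyUpTo-∷ʳ suc m)))))
                    (↭-reflexive (++-identityʳ (range1 m)))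

    α≤m : ∀ {a} → a ∈ α → a ≤ m
    α≤m a∈ = proj₂ (IsPerm-∈ rest↭ (∈-++⁺ˡ a∈))

    1≤β′ : ∀ {c} → c ∈ β′ → 1 ≤ c
    1≤β′ c∈ = proj₁ (IsPerm-∈ rest↭ (∈-++⁺ʳ α c∈))

    -- A letter of α above a letter c of β′ would form the pattern a (m + 1) c.
    α<β′ : Below α β′
    α<β′ {a} {c} a∈ c∈ with <-cmp a c
    ... | tri< a<c _ _ = a<c
    ... | tri≈ _ a≡c _ = ⊥-elim (Unique-++⇒disjoint α (IsPerm-unique π↭) a∈ (there c∈) a≡c)
    ... | tri> _ _ c<a = ⊥-elim (avπ (a , suc m , c , 231-around α β′ a∈ c∈ , c<a , s≤s (α≤m a∈)))

    α<xβ′ : Below α (suc m ∷ β′)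
    α<xβ′ a∈ (here refl) = s≤s (α≤m a∈)
    α<xβ′ a∈ (there c∈)  = α<β′ a∈ c∈

    -- α lies below max α and β′ above it, so filtering [m] at max α splits it as α ++ β′.
    i : ℕ
    i = max 0 α

    i≤m : i ≤ m
    i≤m = max≤v⁺ z≤n (tabulate α≤m)

    i<β′ : All (i <_) β′
    i<β′ = tabulate (λ c∈ → max<v⁺ (1≤β′ c∈) (tabulate (λ a∈ → α<β′ a∈ c∈)))

    split↭ : α ++ β′ ↭ range1 i ++ map (i +_) (range1 (m ∸ i))
    split↭ = ↭-trans rest↭ (↭-reflexive (trans (cong range1 (sym (m+[n∸m]≡n i≤m))) (range1-++ i (m ∸ i))))

    range1≤i : All (_≤ i) (range1 i)
    range1≤i = tabulate (λ y∈ → proj₂ (∈-range1⁻ y∈))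

    i<shifted : All (i <_) (map (i +_) (range1 (m ∸ i)))
    i<shifted = tabulate λ y∈ → case (∈-map⁻ (i +_) y∈)
      where
      case : ∀ {y} → ∃[ z ] z ∈ range1 (m ∸ i) × y ≡ i + z → i < y
      case (z , z∈ , refl) = m<m+n i (proj₁ (∈-range1⁻ z∈))

    α↭ : IsPerm i α
    α↭ = subst₂ _↭_ (filter-≤-++ i (xs≤max 0 α) i<β′) (filter-≤-++ i range1≤i i<shifted) (↭.filter-↭ (_≤? i) split↭)

    β′↭ : β′ ↭ map (i +_) (range1 (m ∸ i))
    β′↭ = subst₂ _↭_ (filter->-++ i (xs≤max 0 α) i<β′) (filter->-++ i range1≤i i<shifted) (↭.filter-↭ (i <?_) split↭)

    gluing-around : Jacobi (α ++ suc m ∷ β′) → Gluing m (α ++ suc m ∷ β′)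
    gluing-around jπ with ↭.↭-map-inv (i +_) (↭-sym β′↭)
    ... | β , β′≡ , β↭ =
      gluing i α β i≤m ok (α↭ , jα , avα) (↭-sym β↭ , jβ , avβ) (cong (λ t → α ++ suc m ∷ t) β′≡)
      where
      around : Jacobi α × Jacobi β′ × (α ≡ [] ⊎ suc (length β′) % 2 ≡ 0)
      around = Jacobi-around⁻ α α<xβ′ jπ
      jα : Jacobi α
      jα = proj₁ around
      jβ : Jacobi β
      jβ = Jacobi-map-+⁻ i β (subst Jacobi β′≡ (proj₁ (proj₂ around)))
      |β′|≡ : length β′ ≡ m ∸ i
      |β′|≡ = trans (↭.↭-length β′↭) (trans (length-map (i +_) (range1 (m ∸ i))) (length-applyUpTo suc (m ∸ i)))
      ok : gluableᵇ i (m ∸ i) ≡ true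
      ok = around⇒gluableᵇ i (m ∸ i) α↭ (map₂ (subst (λ n → suc n % 2 ≡ 0) |β′|≡) (proj₂ (proj₂ around)))
      avα : Avoids231 α
      avα = Avoids231-⊆ (++⁺ʳ (suc m ∷ β′) ⊆-refl) avπ
      avβ : Avoids231 β
      avβ = Avoids231-map-+⁻ i β (subst Avoids231 β′≡ (Avoids231-⊆ (++⁺ˡ α (suc m ∷ʳ ⊆-refl)) avπ))

  decompose : ∀ m {π} → Jacobi231 (suc m) π → Gluing m π
  decompose m (π↭ , jπ , avπ) with ∈-∃++ (↭.∈-resp-↭ (↭-sym π↭) (∈-range1⁺ {suc m} (s≤s z≤n) ≤-refl))
  ... | α , β′ , refl = Split.gluing-around α β′ π↭ avπ jπ

module UniqueList where

  open import Data.Empty using (⊥)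
  open import Data.List using ([]; _∷_; map; cartesianProductWith)
  open import Data.List.Membership.Propositional using (_∈_)
  open import Data.List.Membership.Propositional.Properties using (∈-map⁻; ∈-cartesianProductWith⁻)
  open import Data.List.Relation.Unary.All using (All; tabulate; lookup)
  open import Data.List.Relation.Unary.Any using (here; there)
  open import Data.List.Relation.Unary.AllPairs using ([]; _∷_)
  open import Data.List.Relation.Unary.Unique.Propositional using (Unique)
  open import Data.List.Relation.Unary.Unique.Propositional.Properties using (++⁺)
  open import Data.Product using (∃-syntax; _×_; _,_; proj₁; proj₂)
  open import Relation.Nullary using (¬_)
  open import Relation.Binary.PropositionalEquality using (_≡_; refl)

  map⁺-on : ∀ {A B : Set} {f : A → B} {xs} → (∀ {x y} → x ∈ xs → y ∈ xs → f x ≡ f y → x ≡ y) →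
            Unique xs → Unique (map f xs)
  map⁺-on         {xs = []}     inj []        = []
  map⁺-on {f = f} {xs = x ∷ xs} inj (x∉ ∷ u) = fresh ∷ map⁺-on (λ x∈ y∈ → inj (there x∈) (there y∈)) u
    where
    fresh : All (λ v → ¬ f x ≡ v) (map f xs)
    fresh = tabulate λ v∈ → case (∈-map⁻ f v∈)
      where
      case : ∀ {v} → ∃[ y ] y ∈ xs × v ≡ f y → ¬ f x ≡ v
      case (y , y∈ , refl) fx≡fy = lookup x∉ y∈ (inj (here refl) (there y∈) fx≡fy)

  cartesianProductWith⁺-on : ∀ {A B C : Set} (f : A → B → C) {xs ys} →
    (∀ {a a′ b b′} → a ∈ xs → a′ ∈ xs → b ∈ ys → b′ ∈ ys → f a b ≡ f a′ b′ → a ≡ a′ × b ≡ b′) →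
    Unique xs → Unique ys → Unique (cartesianProductWith f xs ys)
  cartesianProductWith⁺-on f {[]}     inj []        uy = []
  cartesianProductWith⁺-on f {x ∷ xs} {ys} inj (x∉ ∷ ux) uy =
    ++⁺ (map⁺-on (λ b∈ b′∈ e → proj₂ (inj (here refl) (here refl) b∈ b′∈ e)) uy)
        (cartesianProductWith⁺-on f (λ a∈ a′∈ → inj (there a∈) (there a′∈)) ux uy)
        disjoint
    where
    disjoint : ∀ {v} → v ∈ map (f x) ys × v ∈ cartesianProductWith f xs ys → ⊥
    disjoint (v∈₁ , v∈₂) with ∈-map⁻ (f x) v∈₁ | ∈-cartesianProductWith⁻ f xs ys v∈₂
    ... | b , b∈ , refl | a , b′ , a∈ , b′∈ , e = lookup x∉ a∈ (proj₁ (inj (here refl) (there a∈) b∈ b′∈ e))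

module Generator where

  open import Data.Bool using (true; false; if_then_else_)
  open import Data.Empty using (⊥-elim)
  open import Data.Nat using (ℕ; zero; suc; _∸_; _<_; _≤_; s≤s)
  open import Data.Nat.Properties using (≤-refl; ≤-trans; ≤-pred; <⇒≢; <⇒≤; 1+n≰n; m≤n⇒m≤1+n; m≤n⇒m<n∨m≡n; m∸n≤m; +-cancelˡ-≡)
  open import Data.List using (List; []; _∷_; _++_; [_]; cartesianProductWith)
  open import Data.List.Properties using (∷-injective; map-injective)
  open import Data.List.Membership.Propositional using (_∈_; _∉_)
  open import Data.List.Membership.Propositional.Properties using (∈-++⁻; ∈-++⁺ˡ; ∈-++⁺ʳ; ∈-cartesianProductWith⁺; ∈-cartesianProductWith⁻)
  open import Data.List.Relation.Unary.All using ([])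
  open import Data.List.Relation.Unary.Any using (here; there)
  open import Data.List.Relation.Unary.AllPairs using ([]; _∷_)
  open import Data.List.Relation.Unary.Unique.Propositional using (Unique)
  open import Data.List.Relation.Unary.Unique.Propositional.Properties using (++⁺)
  open import Data.List.Relation.Binary.Permutation.Propositional using (↭-refl)
  open import Data.List.Relation.Binary.Permutation.Propositional.Properties using (↭-empty-inv)
  open import Data.Product using (∃-syntax; _×_; _,_; proj₁; proj₂)
  open import Data.Sum using (inj₁; inj₂)
  open import Data.Unit using (tt)
  open import Relation.Binary.PropositionalEquality using (_≡_; refl; sym; trans)
  open import Relation.Nullary using (¬_)
  open Convolution using (gluableᵇ)
  open Words using (glue)
  open Permutations using (IsPerm-∈; IsPerm-length)
  open Decomposition
  open UniqueList

  piece : (ℕ → List (List ℕ)) → ℕ → ℕ → List (List ℕ)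
  piece G m i = if gluableᵇ i (m ∸ i) then cartesianProductWith (glue (suc m) i) (G i) (G (m ∸ i)) else []

  pieces : (ℕ → List (List ℕ)) → ℕ → ℕ → List (List ℕ)
  pieces G m zero    = []
  pieces G m (suc c) = pieces G m c ++ piece G m c

  -- The fuel f bounds the recursion depth: gen f m is complete only for m ≤ f.
  gen : ℕ → ℕ → List (List ℕ)
  gen f       zero    = [ [] ]
  gen zero    (suc m) = []
  gen (suc f) (suc m) = pieces (gen f) m (suc m)

  ∈-piece⁻ : ∀ G m i {π} → π ∈ piece G m i →
    gluableᵇ i (m ∸ i) ≡ true × ∃[ α ] ∃[ β ] α ∈ G i × β ∈ G (m ∸ i) × π ≡ glue (suc m) i α β
  ∈-piece⁻ G m i π∈ with gluableᵇ i (m ∸ i) | π∈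
  ... | true  | π∈′ = refl , ∈-cartesianProductWith⁻ (glue (suc m) i) (G i) (G (m ∸ i)) π∈′
  ... | false | ()

  ∈-piece⁺ : ∀ G m i {α β} → gluableᵇ i (m ∸ i) ≡ true → α ∈ G i → β ∈ G (m ∸ i) → glue (suc m) i α β ∈ piece G m i
  ∈-piece⁺ G m i ok α∈ β∈ rewrite ok = ∈-cartesianProductWith⁺ (glue (suc m) i) α∈ β∈

  ∈-pieces⁻ : ∀ G m c {π} → π ∈ pieces G m c → ∃[ i ] i < c × π ∈ piece G m i
  ∈-pieces⁻ G m (suc c) π∈ with ∈-++⁻ (pieces G m c) π∈
  ... | inj₂ π∈′ = c , ≤-refl , π∈′
  ... | inj₁ π∈′ with ∈-pieces⁻ G m c π∈′
  ...   | i , i<c , π∈″ = i , m≤n⇒m≤1+n i<c , π∈″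

  ∈-pieces⁺ : ∀ G m c {i π} → i < c → π ∈ piece G m i → π ∈ pieces G m c
  ∈-pieces⁺ G m (suc c) {i} i<1+c π∈ with m≤n⇒m<n∨m≡n (≤-pred i<1+c)
  ... | inj₁ i<c  = ∈-++⁺ˡ (∈-pieces⁺ G m c i<c π∈)
  ... | inj₂ refl = ∈-++⁺ʳ (pieces G m i) π∈

  gen-sound : ∀ f m {π} → π ∈ gen f m → Jacobi231 m π
  gen-sound f       zero    (here refl) = ↭-refl , tt , λ ()
  gen-sound (suc f) (suc m) π∈ with ∈-pieces⁻ (gen f) m (suc m) π∈
  ... | i , i<1+m , π∈′ with ∈-piece⁻ (gen f) m i π∈′
  ...   | ok , α , β , α∈ , β∈ , π≡ =
    glued (gluing i α β (≤-pred i<1+m) ok (gen-sound f i α∈) (gen-sound f (m ∸ i) β∈) π≡)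

  gen-complete : ∀ f m {π} → m ≤ f → Jacobi231 m π → π ∈ gen f m
  gen-complete f       zero    _         (π↭ , _) rewrite ↭-empty-inv π↭ = here refl
  gen-complete (suc f) (suc m) (s≤s m≤f) π-ok with decompose m π-ok
  ... | gluing i α β i≤m ok α-ok β-ok refl =
    ∈-pieces⁺ (gen f) m (suc m) (s≤s i≤m)
      (∈-piece⁺ (gen f) m i ok (gen-complete f i (≤-trans i≤m m≤f) α-ok)
                               (gen-complete f (m ∸ i) (≤-trans (m∸n≤m m i) m≤f) β-ok))

  around-injective : ∀ {x : ℕ} α α′ {r r′} → x ∉ α → x ∉ α′ → α ++ x ∷ r ≡ α′ ++ x ∷ r′ → α ≡ α′ × r ≡ r′
  around-injective []      []       _   _    refl = refl , refl
  around-injective []      (y ∷ α′) _   x∉α′ eq   = ⊥-elim (x∉α′ (here (proj₁ (∷-injective eq))))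
  around-injective (y ∷ α) []       x∉α _    eq   = ⊥-elim (x∉α (here (sym (proj₁ (∷-injective eq)))))
  around-injective (y ∷ α) (y′ ∷ α′) x∉α x∉α′ eq with ∷-injective eq
  ... | refl , eq′ with around-injective α α′ (λ x∈ → x∉α (there x∈)) (λ x∈ → x∉α′ (there x∈)) eq′
  ...   | refl , r≡r′ = refl , r≡r′

  max∉gen : ∀ f {m i α} → i ≤ m → α ∈ gen f i → suc m ∉ α
  max∉gen f {i = i} i≤m α∈ m+1∈α = 1+n≰n (≤-trans (proj₂ (IsPerm-∈ (proj₁ (gen-sound f i α∈)) m+1∈α)) i≤m)

  glue-injective : ∀ f {m i α α′ β β′} → i ≤ m → α ∈ gen f i → α′ ∈ gen f i →
    glue (suc m) i α β ≡ glue (suc m) i α′ β′ → α ≡ α′ × β ≡ β′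
  glue-injective f {i = i} i≤m α∈ α′∈ eq with around-injective _ _ (max∉gen f i≤m α∈) (max∉gen f i≤m α′∈) eq
  ... | refl , shifted≡ = refl , map-injective (+-cancelˡ-≡ i _ _) shifted≡

  gen-unique : ∀ f m → Unique (gen f m)
  gen-unique f       zero    = [] ∷ []
  gen-unique zero    (suc m) = []
  gen-unique (suc f) (suc m) = pieces-unique (suc m) ≤-refl
    where
    piece-unique : ∀ i → i ≤ m → Unique (piece (gen f) m i)
    piece-unique i i≤m with gluableᵇ i (m ∸ i)
    ... | false = []
    ... | true  = cartesianProductWith⁺-on (glue (suc m) i)
                    (λ α∈ α′∈ _ _ → glue-injective f i≤m α∈ α′∈) (gen-unique f i) (gen-unique f (m ∸ i))
    -- Members of different pieces differ in the position of the maximum.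
    pieces-unique : ∀ c → c ≤ suc m → Unique (pieces (gen f) m c)
    pieces-unique zero    _         = []
    pieces-unique (suc c) (s≤s c≤m) = ++⁺ (pieces-unique c (m≤n⇒m≤1+n c≤m)) (piece-unique c c≤m) disjoint
      where
      disjoint : ∀ {π} → ¬ (π ∈ pieces (gen f) m c × π ∈ piece (gen f) m c)
      disjoint (π∈ , π∈′) with ∈-pieces⁻ (gen f) m c π∈
      ... | i , i<c , π∈″ with ∈-piece⁻ (gen f) m i π∈″ | ∈-piece⁻ (gen f) m c π∈′
      ...   | _ , α , _ , α∈ , _ , refl | _ , α′ , _ , α′∈ , _ , eq
        with around-injective α α′ (max∉gen f (≤-trans (<⇒≤ i<c) c≤m) α∈) (max∉gen f c≤m α′∈) eq
      ...     | refl , _ =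
        <⇒≢ i<c (trans (sym (IsPerm-length (proj₁ (gen-sound f i α∈)))) (IsPerm-length (proj₁ (gen-sound f c α′∈))))

module Counting where

  open import Data.Bool using (true; false)
  open import Data.Empty using (⊥-elim)
  open import Data.Maybe using (just)
  import Data.Maybe as Maybe
  open import Data.Maybe.Properties using (just-injective) renaming (≡-dec to ≡-decᴹ)
  open import Data.Nat as ℕ using (ℕ; zero; suc; _+_; _∸_; _<_; _≤_; _≟_; _≤?_; s≤s; z≤n)
  open import Data.Nat.Properties using (≤-refl; ≤-trans; <-irrefl; m+n∸m≡n; m+[n∸m]≡n; m≤n⇒m∸n≡0; ≰⇒>; <⇒≤)
  open import Data.Integer as ℤ using (ℤ; +_; 0ℤ; 1ℤ)
  open import Data.Integer.Properties using (pos-*; *-identityˡ)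
  open import Data.List using (List; []; _∷_; _++_; [_]; _∷ʳ_; map; length; filter; last; cartesianProductWith; initLast; _∷ʳ′_)
  open import Data.List.Properties using (filter-++; length-++; filter-accept; filter-reject; last-map)
  open import Data.List.Membership.Propositional using (_∈_)
  open import Data.List.Membership.Propositional.Properties using (∈-filter⁺; ∈-filter⁻)
  open import Data.List.Relation.Unary.Any using (here; there)
  open import Data.List.Relation.Unary.Unique.Propositional.Properties using (filter⁺)
  open import Data.Product using (∃-syntax; _×_; _,_; proj₁)
  open import Function.Bundles using (_⇔_; mk⇔; Equivalence)
  open import Relation.Binary.PropositionalEquality using (_≡_; refl; sym; trans; cong; cong₂; subst; module ≡-Reasoning)
  open import Relation.Nullary using (Dec; yes; no; ¬_)
  open import Relation.Unary using (Pred; Decidable)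
  open import Level using (0ℓ)
  open import Defs using (IsPerm; LastIs; JLast; HasCount)
  open Sum
  open ClosedForm using (closedForm)
  open Convolution
  open Words using (glue)
  open Permutations using (IsPerm-∈; IsPerm-length)
  open Decomposition using (Jacobi231; gluableᵇ⇒odd)
  open Generator

  endsIn? : ∀ k (π : List ℕ) → Dec (last π ≡ just k)
  endsIn? k π = ≡-decᴹ _≟_ (last π) (just k)

  count : ℕ → List (List ℕ) → ℕ
  count k L = length (filter (endsIn? k) L)

  count-++ : ∀ k xs ys → count k (xs ++ ys) ≡ count k xs + count k ys
  count-++ k xs ys = trans (cong length (filter-++ (endsIn? k) xs ys)) (length-++ (filter (endsIn? k) xs))

  last-++-∷ : ∀ α (x : ℕ) r → last (α ++ x ∷ r) ≡ last (x ∷ r)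
  last-++-∷ []          x r = refl
  last-++-∷ (y ∷ [])    x r = refl
  last-++-∷ (y ∷ z ∷ α) x r = last-++-∷ (z ∷ α) x r

  last-∈ : ∀ {l} (π : List ℕ) → last π ≡ just l → l ∈ π
  last-∈ (y ∷ [])    refl = here refl
  last-∈ (y ∷ z ∷ π) eq   = there (last-∈ (z ∷ π) eq)

  last-∷ : ∀ (y : ℕ) ys → ∃[ l ] last (y ∷ ys) ≡ just l
  last-∷ y []       = y , refl
  last-∷ y (z ∷ ys) = last-∷ z ys

  LastIs⇔last≡ : ∀ k π → LastIs k π ⇔ (last π ≡ just k)
  LastIs⇔last≡ k π = mk⇔ to (from π)
    where
    to : LastIs k π → last π ≡ just k
    to (σ , refl) = last-++-∷ σ k []
    from : ∀ π → last π ≡ just k → LastIs k π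
    from π eq with initLast π
    from .[]       () | []
    from .(σ ∷ʳ x) eq | σ ∷ʳ′ x = σ , cong (σ ∷ʳ_) (just-injective (trans (sym (last-++-∷ σ x [])) eq))

  IsPerm-last : ∀ {b π} → IsPerm (suc b) π → ∃[ l ] last π ≡ just l × 1 ≤ l × l ≤ suc b
  IsPerm-last {π = []}     π↭ with () ← IsPerm-length π↭
  IsPerm-last {π = y ∷ ys} π↭ with last-∷ y ys
  ... | l , eq = l , eq , IsPerm-∈ π↭ (last-∈ (y ∷ ys) eq)

  length-filter-map-on : ∀ {A B : Set} {P : Pred A 0ℓ} {Q : Pred B 0ℓ} (P? : Decidable P) (Q? : Decidable Q) (g : B → A) bs →
    (∀ {b} → b ∈ bs → P (g b) ⇔ Q b) →
    length (filter P? (map g bs)) ≡ length (filter Q? bs)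
  length-filter-map-on P? Q? g []       P⇔Q = refl
  length-filter-map-on P? Q? g (b ∷ bs) P⇔Q with P? (g b) | Q? b
  ... | yes _  | yes _  = cong suc (length-filter-map-on P? Q? g bs (λ b∈ → P⇔Q (there b∈)))
  ... | no  _  | no  _  = length-filter-map-on P? Q? g bs (λ b∈ → P⇔Q (there b∈))
  ... | yes p  | no ¬q  = ⊥-elim (¬q (Equivalence.to (P⇔Q (here refl)) p))
  ... | no ¬p  | yes q  = ⊥-elim (¬p (Equivalence.from (P⇔Q (here refl)) q))

  shifted-end : ∀ i l k → 1 ≤ l → (just (i + l) ≡ just k) ⇔ (just l ≡ just (k ∸ i))
  shifted-end i l k 1≤l = mk⇔ to from
    where
    to : just (i + l) ≡ just k → just l ≡ just (k ∸ i)
    to refl = cong just (sym (m+n∸m≡n i l))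
    from : just l ≡ just (k ∸ i) → just (i + l) ≡ just k
    from eq with i ≤? k
    ... | yes i≤k = cong just (trans (cong (_+_ i) (just-injective eq)) (m+[n∸m]≡n i≤k))
    ... | no  i≰k = ⊥-elim (<-irrefl refl (subst (1 ≤_) (trans (just-injective eq) (m≤n⇒m∸n≡0 (<⇒≤ (≰⇒> i≰k)))) 1≤l))

  last-glue : ∀ x i α {β l} → last β ≡ just l → last (glue x i α β) ≡ just (i + l)
  last-glue x i α {y ∷ ys} eq = trans (last-++-∷ α x _) (trans (last-map (_+_ i) (y ∷ ys)) (cong (Maybe.map (_+_ i)) eq))

  count-glue : ∀ x i k As Bs → (∀ {β} → β ∈ Bs → ∃[ l ] last β ≡ just l × 1 ≤ l) →
    count k (cartesianProductWith (glue x i) As Bs) ≡ length As ℕ.* count (k ∸ i) Bs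
  count-glue x i k []       Bs ends = refl
  count-glue x i k (α ∷ As) Bs ends = begin
    count k (map (glue x i α) Bs ++ cartesianProductWith (glue x i) As Bs)
      ≡⟨ count-++ k (map (glue x i α) Bs) _ ⟩
    count k (map (glue x i α) Bs) + count k (cartesianProductWith (glue x i) As Bs)
      ≡⟨ cong₂ _+_ (length-filter-map-on (endsIn? k) (endsIn? (k ∸ i)) (glue x i α) Bs shift) (count-glue x i k As Bs ends) ⟩
    count (k ∸ i) Bs + length As ℕ.* count (k ∸ i) Bs ∎
    where
    open ≡-Reasoning
    shift : ∀ {β} → β ∈ Bs → (last (glue x i α β) ≡ just k) ⇔ (last β ≡ just (k ∸ i))
    shift β∈ with ends β∈
    ... | l , eq , 1≤l = mk⇔ (λ e → trans eq (to (trans (sym (last-glue x i α eq)) e)))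
                             (λ e → trans (last-glue x i α eq) (from (trans (sym eq) e)))
      where open Equivalence (shifted-end i l k 1≤l)

  partition : ∀ N L → (∀ {π} → π ∈ L → ∃[ l ] last π ≡ just l × l < N) → + length L ≡ ∑[ j < N ] (+ count j L)
  partition N []      _    = sym (∑-zero N (λ _ _ → refl))
  partition N (π ∷ L) ends with ends (here refl)
  ... | l , eq , l<N = begin
    1ℤ ℤ.+ + length L
      ≡⟨ cong₂ ℤ._+_ (sym single) (partition N L (λ π∈ → ends (there π∈))) ⟩
    ∑[ j < N ] (+ count j [ π ]) ℤ.+ ∑[ j < N ] (+ count j L)
      ≡⟨ ∑-distrib-+ N (λ j → + count j [ π ]) (λ j → + count j L) ⟨
    ∑[ j < N ] (+ count j [ π ] ℤ.+ + count j L)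
      ≡⟨ ∑-cong N (λ j _ → cong +_ (sym (count-++ j [ π ] L))) ⟩
    ∑[ j < N ] (+ count j (π ∷ L)) ∎
    where
    open ≡-Reasoning
    single : ∑[ j < N ] (+ count j [ π ]) ≡ 1ℤ
    single = trans (∑-single N l l<N others) (cong (λ xs → + length xs) (filter-accept (endsIn? l) {π} {[]} eq))
      where
      others : ∀ j → j < N → ¬ j ≡ l → + count j [ π ] ≡ 0ℤ
      others j _ j≢l = cong (λ xs → + length xs) (filter-reject (endsIn? j) {π} {[]} (λ e → j≢l (just-injective (trans (sym e) eq))))

  gen-ends : ∀ f b {π} → π ∈ gen f (suc b) → ∃[ l ] last π ≡ just l × 1 ≤ l × l ≤ suc b
  gen-ends f b π∈ = IsPerm-last (proj₁ (gen-sound f (suc b) π∈))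

  lastCount : ℕ → ℕ → ℕ → ℤ
  lastCount f m k = + count k (gen f m)

  length-gen≡total : ∀ f i → + length (gen f i) ≡ total (lastCount f) i
  length-gen≡total f zero    = refl
  length-gen≡total f (suc i) = partition (suc (suc i)) (gen f (suc i)) ends
    where
    ends : ∀ {π} → π ∈ gen f (suc i) → ∃[ l ] last π ≡ just l × l < suc (suc i)
    ends π∈ with gen-ends f i π∈
    ... | l , eq , _ , l≤ = l , eq , s≤s l≤

  count-pieces : ∀ G m k c → + count k (pieces G m c) ≡ ∑[ i < c ] (+ count k (piece G m i))
  count-pieces G m k zero    = refl
  count-pieces G m k (suc c) =
    trans (cong +_ (count-++ k (pieces G m c) (piece G m c))) (cong (ℤ._+ + count k (piece G m c)) (count-pieces G m k c))

  gluable⇒1≤rest : ∀ m i → 1 ≤ m → gluableᵇ i (m ∸ i) ≡ true → 1 ≤ m ∸ i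
  gluable⇒1≤rest m zero    1≤m _  = 1≤m
  gluable⇒1≤rest m (suc i) _   ok with m ∸ suc i | gluableᵇ⇒odd i (m ∸ suc i) ok
  ... | suc b | _ = s≤s z≤n

  count-piece : ∀ f m k i → 1 ≤ m →
    + count k (piece (gen f) m i) ≡ 𝟙 (gluableᵇ i (m ∸ i)) ℤ.* (total (lastCount f) i ℤ.* lastCount f (m ∸ i) (k ∸ i))
  count-piece f m k i 1≤m with gluableᵇ i (m ∸ i) in ok
  ... | false = refl
  ... | true  with m ∸ i | gluable⇒1≤rest m i 1≤m ok
  ...   | suc b | _ = begin
    + count k (cartesianProductWith (glue (suc m) i) (gen f i) (gen f (suc b)))
      ≡⟨ cong +_ (count-glue (suc m) i k (gen f i) (gen f (suc b)) ends) ⟩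
    + (length (gen f i) ℕ.* count (k ∸ i) (gen f (suc b)))
      ≡⟨ pos-* (length (gen f i)) _ ⟩
    + length (gen f i) ℤ.* lastCount f (suc b) (k ∸ i)
      ≡⟨ cong (ℤ._* lastCount f (suc b) (k ∸ i)) (length-gen≡total f i) ⟩
    total (lastCount f) i ℤ.* lastCount f (suc b) (k ∸ i)
      ≡⟨ *-identityˡ _ ⟨
    1ℤ ℤ.* (total (lastCount f) i ℤ.* lastCount f (suc b) (k ∸ i)) ∎
    where
    open ≡-Reasoning
    ends : ∀ {β} → β ∈ gen f (suc b) → ∃[ l ] last β ≡ just l × 1 ≤ l
    ends β∈ with gen-ends f b β∈
    ... | l , eq , 1≤l , _ = l , eq , 1≤l

  lastCount-convolve : ∀ f m k → 1 ≤ m → lastCount (suc f) (suc m) k ≡ convolve (lastCount f) m k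
  lastCount-convolve f m k 1≤m =
    trans (count-pieces (gen f) m k (suc m)) (∑-cong (suc m) (λ i _ → count-piece f m k i 1≤m))

  lastCount≡closedForm : ∀ f m k → m ≤ f → lastCount f m k ≡ closedForm m k
  lastCount≡closedForm f       zero    k _ = refl
  lastCount≡closedForm (suc f) (suc zero) zero          _ = refl
  lastCount≡closedForm (suc f) (suc zero) (suc zero)    _ = refl
  lastCount≡closedForm (suc f) (suc zero) (suc (suc k)) _ = refl
  lastCount≡closedForm (suc f) (suc (suc m)) k (s≤s m+1≤f) = begin
    lastCount (suc f) (suc (suc m)) k  ≡⟨ lastCount-convolve f (suc m) k (s≤s z≤n) ⟩
    convolve (lastCount f) (suc m) k   ≡⟨ convolve-cong (suc m) k (λ b b≤ j → lastCount≡closedForm f b j (≤-trans b≤ m+1≤f)) ⟩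
    convolve closedForm (suc m) k      ≡⟨ closedForm-convolve (suc m) k (s≤s z≤n) ⟨
    closedForm (suc (suc m)) k         ∎
    where open ≡-Reasoning

  JLast-count : ∀ m k → HasCount (JLast m k) (count k (gen m m))
  JLast-count m k = filter (endsIn? k) (gen m m) , filter⁺ (endsIn? k) (gen-unique m m) , members , refl
    where
    members : ∀ π → (π ∈ filter (endsIn? k) (gen m m)) ⇔ JLast m k π
    members π = mk⇔ to from
      where
      to : π ∈ filter (endsIn? k) (gen m m) → JLast m k π
      to π∈ with ∈-filter⁻ (endsIn? k) π∈
      ... | π∈gen , ends with gen-sound m m π∈gen
      ...   | π↭ , jπ , avπ = π↭ , jπ , avπ , Equivalence.from (LastIs⇔last≡ k π) ends
      from : JLast m k π → π ∈ filter (endsIn? k) (gen m m)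
      from (π↭ , jπ , avπ , lastIs) =
        ∈-filter⁺ (endsIn? k) (gen-complete m m ≤-refl (π↭ , jπ , avπ)) (Equivalence.to (LastIs⇔last≡ k π) lastIs)

module Rational where

  open import Data.Nat as ℕ using (ℕ; zero; suc; _∸_; _<_; _≤_; s≤s)
  open import Data.Nat.Properties as ℕ using (+-suc; +-∸-assoc; m≤m+n; m+n∸m≡n; m≤n⇒∃[o]m+o≡n)
  open import Data.Nat.Combinatorics using (_C_)
  open import Data.Integer as ℤ using (ℤ; +_; -[1+_]; 0ℤ; 1ℤ)
  open import Data.Integer.Properties using (pos-*)
  open import Data.Integer.Tactic.RingSolver using (solve-∀)
  open import Data.Rational as ℚ using (ℚ; _/_)
  import Data.Rational.Properties as ℚ
  open import Data.Rational.Unnormalised as ℚᵘ using (mkℚᵘ; _≃_; *≡*)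
  import Data.Rational.Unnormalised.Properties as ℚᵘ
  open import Data.Product using (_,_)
  open import Relation.Binary.PropositionalEquality using (_≡_; refl; sym; trans; cong; cong₂; module ≡-Reasoning)
  open import Defs using (binomZ; sumTo; rhsEven; rhsOdd) renaming (term to summand)
  open Sum
  open Binomial
  open Formula

  toℚᵘ-/ : ∀ z d → ℚ.toℚᵘ (z / suc d) ≃ mkℚᵘ z d
  toℚᵘ-/ z d = ℚ.toℚᵘ-fromℚᵘ (mkℚᵘ z d)

  /1-+ : ∀ x y → x / 1 ℚ.+ y / 1 ≡ (x ℤ.+ y) / 1
  /1-+ x y = ℚ.toℚᵘ-injective (begin
    ℚ.toℚᵘ (x / 1 ℚ.+ y / 1)                  ≈⟨ ℚ.toℚᵘ-homo-+ (x / 1) (y / 1) ⟩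
    ℚ.toℚᵘ (x / 1) ℚᵘ.+ ℚ.toℚᵘ (y / 1)        ≈⟨ ℚᵘ.+-cong (toℚᵘ-/ x 0) (toℚᵘ-/ y 0) ⟩
    mkℚᵘ x 0 ℚᵘ.+ mkℚᵘ y 0                    ≈⟨ *≡* (collect x y) ⟩
    mkℚᵘ (x ℤ.+ y) 0                          ≈⟨ ℚᵘ.≃-sym (toℚᵘ-/ (x ℤ.+ y) 0) ⟩
    ℚ.toℚᵘ ((x ℤ.+ y) / 1)                    ∎)
    where
    open ℚᵘ.≃-Reasoning
    collect : ∀ x y → (x ℤ.* 1ℤ ℤ.+ y ℤ.* 1ℤ) ℤ.* 1ℤ ≡ (x ℤ.+ y) ℤ.* 1ℤ
    collect = solve-∀

  private
    cross : ∀ p x y b a → p ℤ.* y ≡ + suc a ℤ.* b → p ℤ.* x ℤ.* y ℤ.* 1ℤ ≡ b ℤ.* x ℤ.* + suc (a ℕ.* 1 ℕ.* 1)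
    cross p x y b a p*y≡[1+a]*b = begin
      p ℤ.* x ℤ.* y ℤ.* 1ℤ        ≡⟨ regroup p x y ⟩
      x ℤ.* (p ℤ.* y)             ≡⟨ cong (x ℤ.*_) p*y≡[1+a]*b ⟩
      x ℤ.* (+ suc a ℤ.* b)       ≡⟨ regroup′ x (+ suc a) b ⟩
      b ℤ.* x ℤ.* + suc a         ≡⟨ cong (λ d → b ℤ.* x ℤ.* + suc d) (sym (trans (ℕ.*-identityʳ (a ℕ.* 1)) (ℕ.*-identityʳ a))) ⟩
      b ℤ.* x ℤ.* + suc (a ℕ.* 1 ℕ.* 1) ∎
      where
      open ≡-Reasoning
      regroup : ∀ p x y → p ℤ.* x ℤ.* y ℤ.* 1ℤ ≡ x ℤ.* (p ℤ.* y)
      regroup = solve-∀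
      regroup′ : ∀ x c b → x ℤ.* (c ℤ.* b) ≡ b ℤ.* x ℤ.* c
      regroup′ = solve-∀

  /-*-/1-*-/1 : ∀ p x y b a → p ℤ.* y ≡ + suc a ℤ.* b → (p / suc a) ℚ.* (x / 1) ℚ.* (y / 1) ≡ (b ℤ.* x) / 1
  /-*-/1-*-/1 p x y b a p*y≡[1+a]*b = ℚ.toℚᵘ-injective (begin
    ℚ.toℚᵘ ((p / suc a) ℚ.* (x / 1) ℚ.* (y / 1))
      ≈⟨ ℚ.toℚᵘ-homo-* ((p / suc a) ℚ.* (x / 1)) (y / 1) ⟩
    ℚ.toℚᵘ ((p / suc a) ℚ.* (x / 1)) ℚᵘ.* ℚ.toℚᵘ (y / 1)
      ≈⟨ ℚᵘ.*-cong (ℚᵘ.≃-trans (ℚ.toℚᵘ-homo-* (p / suc a) (x / 1)) (ℚᵘ.*-cong (toℚᵘ-/ p a) (toℚᵘ-/ x 0))) (toℚᵘ-/ y 0) ⟩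
    mkℚᵘ p a ℚᵘ.* mkℚᵘ x 0 ℚᵘ.* mkℚᵘ y 0
      ≈⟨ *≡* (cross p x y b a p*y≡[1+a]*b) ⟩
    mkℚᵘ (b ℤ.* x) 0
      ≈⟨ ℚᵘ.≃-sym (toℚᵘ-/ (b ℤ.* x) 0) ⟩
    ℚ.toℚᵘ ((b ℤ.* x) / 1) ∎)
    where open ℚᵘ.≃-Reasoning

  numerator*C≡*ballot : ∀ a m → (+ suc (suc a) ℤ.- + (3 ℕ.* m ℕ.+ 1)) ℤ.* + (suc a C m) ≡ + suc a ℤ.* ballot (suc a) m
  numerator*C≡*ballot a zero    = refl
  numerator*C≡*ballot a (suc j) = begin
    (1ℤ ℤ.+ A ℤ.- + (3 ℕ.* suc j ℕ.+ 1)) ℤ.* X      ≡⟨ cong (λ z → (1ℤ ℤ.+ A ℤ.- (z ℤ.+ 1ℤ)) ℤ.* X) (pos-* 3 (suc j)) ⟩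
    (1ℤ ℤ.+ A ℤ.- (+ 3 ℤ.* J ℤ.+ 1ℤ)) ℤ.* X         ≡⟨ expand A J X ⟩
    A ℤ.* X ℤ.- + 3 ℤ.* (J ℤ.* X)                   ≡⟨ cong (λ z → A ℤ.* X ℤ.- + 3 ℤ.* z) absorb ⟩
    A ℤ.* X ℤ.- + 3 ℤ.* (A ℤ.* Y)                   ≡⟨ collect A X Y ⟩
    A ℤ.* (X ℤ.- + 3 ℤ.* Y)                         ∎
    where
    open ≡-Reasoning
    A J X Y : ℤ
    A = + suc a
    J = + suc j
    X = + (suc a C suc j)
    Y = + (a C j)
    absorb : J ℤ.* X ≡ A ℤ.* Y
    absorb = trans (sym (pos-* (suc j) _)) (trans (cong +_ ([k+1]*[n+1]C[k+1]≡[n+1]*nCk a j)) (pos-* (suc a) _))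
    expand : ∀ A J X → (1ℤ ℤ.+ A ℤ.- (+ 3 ℤ.* J ℤ.+ 1ℤ)) ℤ.* X ≡ A ℤ.* X ℤ.- + 3 ℤ.* (J ℤ.* X)
    expand = solve-∀
    collect : ∀ A X Y → A ℤ.* X ℤ.- + 3 ℤ.* (A ℤ.* Y) ≡ A ℤ.* (X ℤ.- + 3 ℤ.* Y)
    collect = solve-∀

  binomZ≡binom : ∀ t q → + binomZ t q ≡ binom (+ t) q
  binomZ≡binom t (+ q)     = refl
  binomZ≡binom t -[1+ q ]  = refl

  summand≡term : ∀ e n k m t → + t ≡ + suc n ℤ.- + m ℤ.- 1ℤ ℤ.+ + e →
    summand t (suc n) (suc k) m ≡ term e (suc n) (suc k) m / 1
  summand≡term e n k m t t≡ rewrite +-suc n k =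
    trans (/-*-/1-*-/1 (+ suc (suc (n ℕ.+ k)) ℤ.- + (3 ℕ.* m ℕ.+ 1)) (+ binomZ t (+ suc k ℤ.- + (2 ℕ.* m ℕ.+ 1)))
                       (+ (suc (n ℕ.+ k) C m)) (ballot (suc (n ℕ.+ k)) m) (n ℕ.+ k) (numerator*C≡*ballot (n ℕ.+ k) m))
          (cong (λ x → (ballot (suc (n ℕ.+ k)) m ℤ.* x) / 1) (trans (binomZ≡binom t _) (cong₂ binom t≡ lower)))
    where
    lower : + suc k ℤ.- + (2 ℕ.* m ℕ.+ 1) ≡ + suc k ℤ.- + 2 ℤ.* + m ℤ.- 1ℤ
    lower = trans (cong (λ z → + suc k ℤ.- (z ℤ.+ 1ℤ)) (pos-* 2 m)) (shift (+ suc k) (+ m))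
      where
      shift : ∀ a b → a ℤ.- (+ 2 ℤ.* b ℤ.+ 1ℤ) ≡ a ℤ.- + 2 ℤ.* b ℤ.- 1ℤ
      shift = solve-∀

  sumTo≡∑ : ∀ N (f : ℕ → ℚ) (g : ℕ → ℤ) → (∀ m → m < N → f m ≡ g m / 1) → sumTo N f ≡ ∑ N g / 1
  sumTo≡∑ zero    f g f≡g = refl
  sumTo≡∑ (suc N) f g f≡g =
    trans (cong₂ ℚ._+_ (sumTo≡∑ N f g (λ m m<N → f≡g m (ℕ.m≤n⇒m≤1+n m<N))) (f≡g N ℕ.≤-refl)) (/1-+ (∑ N g) (g N))

  private
    [1+m+o]∸m≡1+o : ∀ m o → suc (m ℕ.+ o) ∸ m ≡ suc o
    [1+m+o]∸m≡1+o m o = trans (+-∸-assoc 1 (m≤m+n m o)) (cong suc (m+n∸m≡n m o))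

  rhsEven≡formula : ∀ n k → rhsEven (suc n) (suc k) ≡ formula 0 (suc n) (suc k) / 1
  rhsEven≡formula n k = sumTo≡∑ (suc n) _ _ λ m m<1+n → summand≡term 0 n k m _ (upper m m<1+n)
    where
    upper : ∀ m → m < suc n → + (suc n ∸ m ∸ 1) ≡ + suc n ℤ.- + m ℤ.- 1ℤ ℤ.+ + 0
    upper m (s≤s m≤n) with m≤n⇒∃[o]m+o≡n m≤n
    ... | o , refl = trans (cong (λ x → + (x ∸ 1)) ([1+m+o]∸m≡1+o m o)) (sym (cancel (+ m) (+ o)))
      where
      cancel : ∀ a b → 1ℤ ℤ.+ (a ℤ.+ b) ℤ.- a ℤ.- 1ℤ ℤ.+ 0ℤ ≡ b
      cancel = solve-∀

  rhsOdd≡formula : ∀ n k → rhsOdd (suc n) (suc k) ≡ formula 1 (suc n) (suc k) / 1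
  rhsOdd≡formula n k = sumTo≡∑ (suc n) _ _ λ m m<1+n → summand≡term 1 n k m _ (upper m m<1+n)
    where
    upper : ∀ m → m < suc n → + (suc n ∸ m) ≡ + suc n ℤ.- + m ℤ.- 1ℤ ℤ.+ + 1
    upper m (s≤s m≤n) with m≤n⇒∃[o]m+o≡n m≤n
    ... | o , refl = trans (cong +_ ([1+m+o]∸m≡1+o m o)) (sym (cancel (+ m) (+ o)))
      where
      cancel : ∀ a b → 1ℤ ℤ.+ (a ℤ.+ b) ℤ.- a ℤ.- 1ℤ ℤ.+ 1ℤ ≡ 1ℤ ℤ.+ b
      cancel = solve-∀


open import Defs
open import Data.Nat using (ℕ; zero; suc; _≤_; _+_; _*_; z≤n)
open import Data.Nat.Properties using (≤-refl; +-identityʳ)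
open import Data.Integer using (+_)
open import Data.Rational using (_/_)
open import Data.Product using (Σ; _×_; _,_)
open import Relation.Binary.PropositionalEquality using (_≡_; cong; module ≡-Reasoning)
open Formula using (formula)
open ClosedForm using (closedForm; closedForm-2n+e)
open Generator using (gen)
open Counting using (count; JLast-count; lastCount≡closedForm)
open Rational using (rhsEven≡formula; rhsOdd≡formula)

theorem5p11 : ∀ (n k : ℕ) → 1 ≤ n → 1 ≤ k →
    (Σ ℕ λ N → HasCount (JLast (2 * n) k) N × ((+ N) / 1 ≡ rhsEven n k))
    × (Σ ℕ λ N → HasCount (JLast (2 * n + 1) k) N × ((+ N) / 1 ≡ rhsOdd n k))
theorem5p11 (suc n) (suc k) _ _ =
  (count (suc k) (gen even even) , JLast-count even (suc k) , even-value) ,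
  (count (suc k) (gen odd odd)   , JLast-count odd (suc k)  , odd-value)
  where
  open ≡-Reasoning
  even odd : ℕ
  even = 2 * suc n
  odd  = 2 * suc n + 1
  even-value : + count (suc k) (gen even even) / 1 ≡ rhsEven (suc n) (suc k)
  even-value = begin
    + count (suc k) (gen even even) / 1  ≡⟨ cong (_/ 1) (lastCount≡closedForm even even (suc k) ≤-refl) ⟩
    closedForm even (suc k) / 1          ≡⟨ cong (λ m → closedForm m (suc k) / 1) (+-identityʳ even) ⟨
    closedForm (even + 0) (suc k) / 1    ≡⟨ cong (_/ 1) (closedForm-2n+e n 0 (suc k) z≤n) ⟩
    formula 0 (suc n) (suc k) / 1        ≡⟨ rhsEven≡formula n k ⟨
    rhsEven (suc n) (suc k)              ∎
  odd-value : + count (suc k) (gen odd odd) / 1 ≡ rhsOdd (suc n) (suc k)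
  odd-value = begin
    + count (suc k) (gen odd odd) / 1    ≡⟨ cong (_/ 1) (lastCount≡closedForm odd odd (suc k) ≤-refl) ⟩
    closedForm odd (suc k) / 1           ≡⟨ cong (_/ 1) (closedForm-2n+e n 1 (suc k) ≤-refl) ⟩
    formula 1 (suc n) (suc k) / 1        ≡⟨ rhsOdd≡formula n k ⟨
    rhsOdd (suc n) (suc k)               ∎
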